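{- Let $q$ be a prime power. In ${\rm PG}(7,q)$ let $U_i$ be the point with $1$ in position $i$ and $0$ elsewhere, let $\Sigma=\langle U_5,U_6,U_7,U_8\rangle$ and $\Sigma'=\langle U_1,U_2,U_3,U_4\rangle$. Let $\mathcal A$ be a $(4\times4,2)_q$ MRD--code and $\mathcal X=\{L(A)\mid A\in\mathcal A\}$. Let $\mathcal P$ be a $1$--parallelism of $\Sigma$, $\mathcal P'$ a $1$--parallelism of $\Sigma'$, and $\mu:\mathcal P'\to\mathcal P$ a bijection. For a line $\ell'$ of $\Sigma'$, let $\mathcal S'_{\ell'}$ be the unique line--spread of $\mathcal P'$ containing $\ell'$, let $\Gamma_{\ell'}=\langle\Sigma,\ell'\rangle$, and let $\mathcal Z_{\ell'}$ be the set of all solids of $\Gamma_{\ell'}$ (different from $\Sigma$) meeting $\Sigma$ exactly in a line belonging to $\mu(\mathcal S'_{\ell'})$; let $\mathcal Z$ be the union of the $\mathcal Z_{\ell'}$ over all lines $\ell'$ of $\Sigma'$. Then there exists a $5$--dimensional subspace $\Lambda$ of ${\rm PG}(7,q)$ containing exactly $q^4(q^2+1)+1$ members of $\mathcal X\cup\mathcal Z\cup\{\Sigma\}$, and such that every hyperplane of ${\rm PG}(7,q)$ through $\Lambda$ contains precisely $q^4(q^2+1)(q^2+q+1)+1$ members of $\mathcal X\cup\mathcal Z\cup\{\Sigma\}$.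
   Context: A solid is a 3--dimensional projective subspace. A $(4\times4,2)_q$ MRD--code is a set of $q^{12}$ matrices in $\mathcal M_{4\times4}({\rm GF}(q))$ with $\mathrm{rank}(A-B)\ge2$ for all distinct $A,B$ in it. For a $4\times4$ matrix $A$, $L(A)$ is the solid of ${\rm PG}(7,q)$ spanned by the points whose coordinate vectors are the rows of $(I_4\,|\,A)$. A line--spread of ${\rm PG}(3,q)$ is a set of $q^2+1$ lines partitioning its points; a $1$--parallelism of ${\rm PG}(3,q)$ is a set of $q^2+q+1$ line--spreads such that every line lies in exactly one of them. -}

module Defs where

open import Level using (0ℓ)
open import Data.Nat using (ℕ; zero; suc) renaming (_+_ to _+ℕ_; _*_ to _*ℕ_; _^_ to _^ℕ_)
open import Data.Fin using (Fin; zero; suc; splitAt)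
import Data.Fin as Fin
open import Relation.Nullary using (yes; no)
open import Data.Sum using (_⊎_; inj₁; inj₂; [_,_]′)
open import Data.Product using (Σ; ∃; ∃-syntax; _×_; _,_)
open import Data.List using (List)
open import Data.Fin.Permutation using (Permutation′; _⟨$⟩ʳ_)
open import Relation.Binary.PropositionalEquality using (_≡_; _≢_)
open import Relation.Nullary using (¬_)
open import Algebra.Structures using (IsCommutativeRing)
open import Function.Bundles using (_↔_)

record Field : Set₁ where
  infixl 6 _+_
  infixl 7 _*_
  field
    Carrier : Set
    _+_ _*_ : Carrier → Carrier → Carrier
    -_      : Carrier → Carrier
    0# 1#   : Carrier
    isCommutativeRing : IsCommutativeRing _≡_ _+_ _*_ -_ 0# 1#
    0≢1     : 0# ≢ 1#
    inverse : ∀ x → x ≢ 0# → ∃[ y ] (x * y ≡ 1#)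

open import Data.Nat.Primality using (Prime)

IsPrimePower : ℕ → Set
IsPrimePower q = ∃[ p ] ∃[ k ] (Prime p × q ≡ p ^ℕ suc k)

HasOrder : Field → ℕ → Set
HasOrder F q = Field.Carrier F ↔ Fin q

-- A (projective) subspace of PG(n-1,F) is the vector subspace of F^n
-- spanned by a finite tuple of generating vectors; subspaces are compared
-- extensionally (as sets of vectors).

module Geometry (F : Field) where
  open Field F

  Vect : ℕ → Set
  Vect n = Fin n → Carrier

  Gens : ℕ → ℕ → Set
  Gens k n = Fin k → Vect n

  ∑ : ∀ k → (Fin k → Carrier) → Carrier
  ∑ zero    f = 0#
  ∑ (suc k) f = f zero + ∑ k (λ i → f (suc i))

  zeroV : ∀ {n} → Vect n
  zeroV _ = 0#

  lincomb : ∀ {k n} → (Fin k → Carrier) → Gens k n → Vect n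
  lincomb {k} c g j = ∑ k (λ i → c i * g i j)

  _∈⟨_⟩ : ∀ {k n} → Vect n → Gens k n → Set
  v ∈⟨ g ⟩ = ∃[ c ] (∀ j → lincomb c g j ≡ v j)

  LinIndep : ∀ {k n} → Gens k n → Set
  LinIndep {k} g = ∀ c → (∀ j → lincomb c g j ≡ 0#) → ∀ i → c i ≡ 0#

  IsZero : ∀ {n} → Vect n → Set
  IsZero v = ∀ j → v j ≡ 0#

  _⊆_ : ∀ {k m n} → Gens k n → Gens m n → Set
  S ⊆ T = ∀ v → v ∈⟨ S ⟩ → v ∈⟨ T ⟩

  _≈_ : ∀ {k m n} → Gens k n → Gens m n → Set
  S ≈ T = (S ⊆ T) × (T ⊆ S)

  join : ∀ {k m n} → Gens k n → Gens m n → Gens (k +ℕ m) n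
  join {k} S T i = [ S , T ]′ (splitAt k i)

  -- subspaces of projective dimension d are given by d+1 independent
  -- generators; points, lines, solids, 5-spaces, hyperplanes of PG(7,q)
  Line  : ℕ → Set
  Line n = Gens 2 n

  Solid : ℕ → Set
  Solid n = Gens 4 n

  IsLineOf : ∀ {n} → Line n → Solid n → Set
  IsLineOf ℓ Π = LinIndep ℓ × ℓ ⊆ Π

  SpreadIx : ℕ → Set
  SpreadIx q = Fin (suc (q *ℕ q))

  ParIx : ℕ → Set
  ParIx q = Fin (suc (q *ℕ q +ℕ q))

  Spread : ℕ → ℕ → Set
  Spread q n = SpreadIx q → Line n

  IsLineSpread : ∀ {n} (q : ℕ) → Solid n → Spread q n → Set
  IsLineSpread q Π ls =
      (∀ i → IsLineOf (ls i) Π)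
    × (∀ v → v ∈⟨ Π ⟩ → ¬ IsZero v → ∃[ i ] (v ∈⟨ ls i ⟩))
    × (∀ i j → i ≢ j → ∀ v → v ∈⟨ ls i ⟩ → v ∈⟨ ls j ⟩ → IsZero v)

  _∈Sp_ : ∀ {m n} → Line n → (Fin m → Line n) → Set
  ℓ ∈Sp ls = ∃[ i ] (ℓ ≈ ls i)

  Parallelism : ℕ → ℕ → Set
  Parallelism q n = ParIx q → Spread q n

  IsParallelism : ∀ {n} (q : ℕ) → Solid n → Parallelism q n → Set
  IsParallelism q Π P =
      (∀ j → IsLineSpread q Π (P j))
    × (∀ ℓ → IsLineOf ℓ Π →
         ∃[ j ] (ℓ ∈Sp P j) × (∀ j j′ → ℓ ∈Sp P j → ℓ ∈Sp P j′ → j ≡ j′))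

  Mat : Set
  Mat = Fin 4 → Fin 4 → Carrier

  _-M_ : Mat → Mat → Mat
  (A -M B) i j = A i j + (- B i j)

  RankAtLeast : ℕ → Mat → Set
  RankAtLeast r M = Σ (Fin r → Fin 4) λ f → LinIndep {r} {4} (λ i → M (f i))

  IsMRD : (q : ℕ) → (Fin (q ^ℕ 12) → Mat) → Set
  IsMRD q A = ∀ i j → i ≢ j → RankAtLeast 2 (A i -M A j)

  δ : ∀ {n} → Fin n → Fin n → Carrier
  δ i j with i Fin.≟ j
  ... | yes _ = 1#
  ... | no  _ = 0#

  U : Fin 8 → Vect 8
  U i = δ i

  -- Σ = ⟨U5,U6,U7,U8⟩ and Σ′ = ⟨U1,U2,U3,U4⟩ (0-based indices 4..7 and 0..3)
  Σs : Solid 8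
  Σs i = U (4 Fin.↑ʳ i)

  Σ′ : Solid 8
  Σ′ i = U (i Fin.↑ˡ 4)

  -- L(A): the solid spanned by the rows of (I_4 | A)
  L : Mat → Solid 8
  L A i j = [ δ i , A i ]′ (splitAt 4 j)

  module Family (q : ℕ) (A : Fin (q ^ℕ 12) → Mat)
                (P : Parallelism q 8) (P′ : Parallelism q 8)
                (μ : Permutation′ (suc (q *ℕ q +ℕ q))) where

    InX : Solid 8 → Set
    InX S = ∃[ i ] (S ≈ L (A i))

    -- S ∈ Z_ℓ′ for some line ℓ′ of Σ′: S is a solid of Γ_ℓ′ = ⟨Σ,ℓ′⟩,
    -- S ≠ Σ, and S ∩ Σ is exactly a line of μ(S′_ℓ′), where S′_ℓ′ = P′ j
    -- is the spread of P′ containing ℓ′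
    InZ : Solid 8 → Set
    InZ S = ∃[ ℓ′ ] ∃[ j ]
        IsLineOf ℓ′ Σ′ × ℓ′ ∈Sp P′ j
      × LinIndep S × S ⊆ join Σs ℓ′ × ¬ (S ≈ Σs)
      × ∃[ i ] (∀ v → ((v ∈⟨ S ⟩ × v ∈⟨ Σs ⟩) → v ∈⟨ P (μ ⟨$⟩ʳ j) i ⟩)
                    × (v ∈⟨ P (μ ⟨$⟩ʳ j) i ⟩ → (v ∈⟨ S ⟩ × v ∈⟨ Σs ⟩)))

    Member : Solid 8 → Set
    Member S = InX S ⊎ InZ S ⊎ (S ≈ Σs)

    ContainsExactly : ∀ {k} → ℕ → Gens k 8 → Set
    ContainsExactly N W =
      Σ (Fin N → Solid 8) λ f → ((∀ i → Member (f i) × f i ⊆ W)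
            × (∀ i j → f i ≈ f j → i ≡ j)
            × (∀ S → Member S → S ⊆ W → ∃[ i ] (S ≈ f i)))

module Submission where

-- Proposition 5.4.  We take Λ = ⟨Σ, U₁, U₂⟩ = Γ_ℓ₀ for the line
-- ℓ₀ = ⟨U₁, U₂⟩ of Σ′; in coordinates Λ = {v : v₃ = v₄ = 0}.
--
-- L(A) contains rows with v₃ = 1 or v₄ = 1, and a
--     hyperplane H ⊇ Λ is the kernel of a form Q·v₃ - P·v₄ with (P, Q) ≠ 0,
--     so no L(A) lies in Λ or in any such H.
-- (2) Members of Z inside Γ_ℓ (ℓ a line of Σ′).  Writing a line m of Σ in
--     echelon form ⟨n₁, n₂⟩, the solids of Γ_ℓ meeting Σ exactly in m are the
--     q⁴ solids Φ α = ⟨n₁, n₂, u₀ + …, u₁ + …⟩, α ∈ F⁴.  The key lemma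
--     ('frontBasis') is that such a solid contains vectors whose fronts
--     (first four coordinates) are those of u₀, u₁; hence a member of Z
--     lying in Γ_ℓ was built on ℓ itself and on a line of μ(S′_ℓ).  So Γ_ℓ
--     contains exactly q⁴(q²+1) members of Z.
-- (3) A hyperplane H ⊇ Λ meets Σ′ in a plane; every member of Z inside H is
--     built on one of its q²+q+1 lines ℓ, and lies in Γ_ℓ ⊆ H.

open import Defs
open import Data.Nat as N using (ℕ; zero; suc; _<_; s≤s; z≤n) renaming (_+_ to _+ℕ_; _*_ to _*ℕ_; _^_ to _^ℕ_)
import Data.Nat.Properties as NP
open import Data.Nat.Solver using (module +-*-Solver)
open import Data.Fin as Fin using (Fin; zero; suc; punchIn; punchOut; _↑ˡ_; _↑ʳ_; splitAt)
import Data.Fin.Properties as FinP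
open import Data.Fin.Permutation using (Permutation′; _⟨$⟩ʳ_)
open import Data.Product using (Σ; _×_; _,_; proj₁; proj₂)
open import Data.Sum using (_⊎_; inj₁; inj₂; [_,_]′)
open import Data.Unit using (⊤; tt)
open import Data.Empty using (⊥; ⊥-elim)
open import Data.Vec.Functional using ([]; _∷_)
open import Relation.Nullary using (¬_; Dec; yes; no)
open import Relation.Binary.PropositionalEquality
open import Relation.Binary.Definitions using (DecidableEquality)
open import Function.Bundles using (_↔_; Inverse)

-- The standard library's ring solver ('Algebra.Solver.Ring') needs a
-- coefficient ring whose equality it can decide by computation, together
-- with a homomorphism into the target ring.  The carrier of an abstract
-- field has no computing equality, so we take integer coefficients and the
-- canonical homomorphism ℤ → F, i ↦ i·1.  The resulting 'solve' proves every
-- identity of commutative rings in F; ':0' and ':1' are the constants 0, 1 of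
-- its expression language.
module RingSolver (F : Field) where
  open import Data.Integer as ℤ using (ℤ; +_; -[1+_]; _⊖_; ∣_∣; sign; _◃_)
  import Data.Integer.Properties as ℤP
  open import Data.Sign as Sign using (Sign)
  open import Data.Maybe using (just; nothing)
  open import Algebra.Bundles using (CommutativeRing)
  import Algebra.Solver.Ring.AlmostCommutativeRing as ACR
  import Algebra.Properties.Ring as RingProperties
  open import Algebra.Structures using (IsCommutativeRing)
  open Field F
  open IsCommutativeRing isCommutativeRing hiding (sym; trans; refl; reflexive)
  open ≡-Reasoning

  commutativeRing : CommutativeRing _ _
  commutativeRing = record { isCommutativeRing = isCommutativeRing }

  open RingProperties (CommutativeRing.ring commutativeRing)
    using (-1*x≈-x; -0#≈0#; -‿+-comm; -‿involutive)

  -- the image n · 1 of a natural number; 1 is sent to 1# on the nose, so that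
  -- the solver's constants ':0' and ':1' denote 0# and 1# definitionally
  fromℕ : ℕ → Carrier
  fromℕ zero          = 0#
  fromℕ (suc zero)    = 1#
  fromℕ (suc (suc n)) = 1# + fromℕ (suc n)

  fromℕ-suc : ∀ n → fromℕ (suc n) ≡ 1# + fromℕ n
  fromℕ-suc zero    = sym (+-identityʳ 1#)
  fromℕ-suc (suc n) = refl

  fromℕ-+ : ∀ m n → fromℕ (m N.+ n) ≡ fromℕ m + fromℕ n
  fromℕ-+ zero    n = sym (+-identityˡ _)
  fromℕ-+ (suc m) n = begin
    fromℕ (suc (m N.+ n))       ≡⟨ fromℕ-suc (m N.+ n) ⟩
    1# + fromℕ (m N.+ n)        ≡⟨ cong (λ z → 1# + z) (fromℕ-+ m n) ⟩
    1# + (fromℕ m + fromℕ n)    ≡⟨ sym (+-assoc _ _ _) ⟩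
    (1# + fromℕ m) + fromℕ n    ≡⟨ cong (_+ fromℕ n) (sym (fromℕ-suc m)) ⟩
    fromℕ (suc m) + fromℕ n     ∎

  fromℕ-* : ∀ m n → fromℕ (m N.* n) ≡ fromℕ m * fromℕ n
  fromℕ-* zero    n = sym (zeroˡ _)
  fromℕ-* (suc m) n = begin
    fromℕ (n N.+ m N.* n)             ≡⟨ fromℕ-+ n (m N.* n) ⟩
    fromℕ n + fromℕ (m N.* n)         ≡⟨ cong (λ z → fromℕ n + z) (fromℕ-* m n) ⟩
    fromℕ n + fromℕ m * fromℕ n       ≡⟨ cong (_+ fromℕ m * fromℕ n) (sym (*-identityˡ _)) ⟩
    1# * fromℕ n + fromℕ m * fromℕ n  ≡⟨ sym (distribʳ _ _ _) ⟩
    (1# + fromℕ m) * fromℕ n          ≡⟨ cong (_* fromℕ n) (sym (fromℕ-suc m)) ⟩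
    fromℕ (suc m) * fromℕ n           ∎

  fromℤ : ℤ → Carrier
  fromℤ (+ n)    = fromℕ n
  fromℤ -[1+ n ] = - fromℕ (suc n)

  cancel-1# : ∀ a b → (1# + a) + - (1# + b) ≡ a + - b
  cancel-1# a b = begin
    (1# + a) + - (1# + b)     ≡⟨ cong (λ z → (1# + a) + z) (sym (-‿+-comm 1# b)) ⟩
    (1# + a) + (- 1# + - b)   ≡⟨ +-assoc _ _ _ ⟩
    1# + (a + (- 1# + - b))   ≡⟨ cong (λ z → 1# + z) (sym (+-assoc _ _ _)) ⟩
    1# + ((a + - 1#) + - b)   ≡⟨ cong (λ z → 1# + (z + - b)) (+-comm a (- 1#)) ⟩
    1# + ((- 1# + a) + - b)   ≡⟨ cong (λ z → 1# + z) (+-assoc _ _ _) ⟩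
    1# + (- 1# + (a + - b))   ≡⟨ sym (+-assoc _ _ _) ⟩
    (1# + - 1#) + (a + - b)   ≡⟨ cong (_+ (a + - b)) (-‿inverseʳ 1#) ⟩
    0# + (a + - b)            ≡⟨ +-identityˡ _ ⟩
    a + - b                   ∎

  fromℤ-⊖ : ∀ m n → fromℤ (m ⊖ n) ≡ fromℕ m + - fromℕ n
  fromℤ-⊖ zero    zero    = sym (trans (+-identityˡ _) -0#≈0#)
  fromℤ-⊖ zero    (suc n) = sym (+-identityˡ _)
  fromℤ-⊖ (suc m) zero    = sym (trans (cong (λ z → fromℕ (suc m) + z) -0#≈0#) (+-identityʳ _))
  fromℤ-⊖ (suc m) (suc n) = begin
    fromℤ (suc m ⊖ suc n)               ≡⟨ cong fromℤ (ℤP.[1+m]⊖[1+n]≡m⊖n m n) ⟩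
    fromℤ (m ⊖ n)                       ≡⟨ fromℤ-⊖ m n ⟩
    fromℕ m + - fromℕ n                 ≡⟨ sym (cancel-1# _ _) ⟩
    (1# + fromℕ m) + - (1# + fromℕ n)   ≡⟨ sym (cong₂ (λ a b → a + - b) (fromℕ-suc m) (fromℕ-suc n)) ⟩
    fromℕ (suc m) + - fromℕ (suc n)     ∎

  fromℤ-neg : ∀ i → fromℤ (ℤ.- i) ≡ - fromℤ i
  fromℤ-neg (+ zero)  = sym -0#≈0#
  fromℤ-neg (+ suc n) = refl
  fromℤ-neg -[1+ n ]  = sym (-‿involutive _)

  fromℤ-+ : ∀ i j → fromℤ (i ℤ.+ j) ≡ fromℤ i + fromℤ j
  fromℤ-+ -[1+ m ] -[1+ n ] = begin
    - fromℕ (suc (suc (m N.+ n)))          ≡⟨ cong (λ z → - fromℕ (suc z)) (sym (NP.+-suc m n)) ⟩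
    - fromℕ (suc m N.+ suc n)              ≡⟨ cong -_ (fromℕ-+ (suc m) (suc n)) ⟩
    - (fromℕ (suc m) + fromℕ (suc n))      ≡⟨ sym (-‿+-comm _ _) ⟩
    - fromℕ (suc m) + - fromℕ (suc n)      ∎
  fromℤ-+ -[1+ m ] (+ n)    = trans (fromℤ-⊖ n (suc m)) (+-comm _ _)
  fromℤ-+ (+ m)    -[1+ n ] = fromℤ-⊖ m (suc n)
  fromℤ-+ (+ m)    (+ n)    = fromℕ-+ m n

  signF : Sign → Carrier
  signF Sign.+ = 1#
  signF Sign.- = - 1#

  fromℤ-◃ : ∀ s n → fromℤ (s ◃ n) ≡ signF s * fromℕ n
  fromℤ-◃ s       zero    = sym (zeroʳ _)
  fromℤ-◃ Sign.+ (suc n) = sym (*-identityˡ _)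
  fromℤ-◃ Sign.- (suc n) = sym (-1*x≈-x _)

  fromℤ-signAbs : ∀ i → fromℤ i ≡ signF (sign i) * fromℕ ∣ i ∣
  fromℤ-signAbs (+ n)    = sym (*-identityˡ _)
  fromℤ-signAbs -[1+ n ] = sym (-1*x≈-x _)

  signF-* : ∀ s t → signF (s Sign.* t) ≡ signF s * signF t
  signF-* Sign.+ t      = sym (*-identityˡ _)
  signF-* Sign.- Sign.+ = sym (*-identityʳ _)
  signF-* Sign.- Sign.- = sym (trans (-1*x≈-x _) (-‿involutive _))

  interchange : ∀ a b c d → (a * b) * (c * d) ≡ (a * c) * (b * d)
  interchange a b c d = begin
    (a * b) * (c * d)   ≡⟨ *-assoc _ _ _ ⟩
    a * (b * (c * d))   ≡⟨ cong (λ z → a * z) (sym (*-assoc _ _ _)) ⟩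
    a * ((b * c) * d)   ≡⟨ cong (λ z → a * (z * d)) (*-comm b c) ⟩
    a * ((c * b) * d)   ≡⟨ cong (λ z → a * z) (*-assoc _ _ _) ⟩
    a * (c * (b * d))   ≡⟨ sym (*-assoc _ _ _) ⟩
    (a * c) * (b * d)   ∎

  fromℤ-* : ∀ i j → fromℤ (i ℤ.* j) ≡ fromℤ i * fromℤ j
  fromℤ-* i j = begin
    fromℤ (sign i Sign.* sign j ◃ ∣ i ∣ N.* ∣ j ∣)
      ≡⟨ fromℤ-◃ (sign i Sign.* sign j) (∣ i ∣ N.* ∣ j ∣) ⟩
    signF (sign i Sign.* sign j) * fromℕ (∣ i ∣ N.* ∣ j ∣)
      ≡⟨ cong₂ _*_ (signF-* (sign i) (sign j)) (fromℕ-* ∣ i ∣ ∣ j ∣) ⟩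
    (signF (sign i) * signF (sign j)) * (fromℕ ∣ i ∣ * fromℕ ∣ j ∣)
      ≡⟨ interchange _ _ _ _ ⟩
    (signF (sign i) * fromℕ ∣ i ∣) * (signF (sign j) * fromℕ ∣ j ∣)
      ≡⟨ sym (cong₂ _*_ (fromℤ-signAbs i) (fromℤ-signAbs j)) ⟩
    fromℤ i * fromℤ j ∎

  fromℤ-homomorphism : ACR._-Raw-AlmostCommutative⟶_ ℤ.+-*-rawRing (ACR.fromCommutativeRing commutativeRing)
  fromℤ-homomorphism = record
    { ⟦_⟧ = fromℤ ; +-homo = fromℤ-+ ; *-homo = fromℤ-* ; -‿homo = fromℤ-neg
    ; 0-homo = refl ; 1-homo = refl }

  coefficient-equality : ∀ i j → _
  coefficient-equality i j with i ℤP.≟ j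
  ... | yes e = just (cong fromℤ e)
  ... | no _  = nothing

  open import Algebra.Solver.Ring ℤ.+-*-rawRing (ACR.fromCommutativeRing commutativeRing)
    fromℤ-homomorphism coefficient-equality public

  :0 :1 : ∀ {n} → Polynomial n
  :0 = con (+ 0)
  :1 = con (+ 1)

-- Everything below the solver lives over a fixed field F whose equality is
-- decidable (for a finite field this comes from the bijection with Fin q).
module OverField (F : Field) (_≟_ : DecidableEquality (Field.Carrier F)) where
  open Field F public
  open Geometry F public
  open RingSolver F public using (solve; _:+_; _:*_; :-_; _:-_; _:=_; :0; :1)

  infixl 6 _-_
  _-_ : Carrier → Carrier → Carrier
  x - y = x + (- y)

  *0 : ∀ x → x * 0# ≡ 0#
  *0 = solve 1 (λ x → x :* :0 := :0) refl
  0* : ∀ x → 0# * x ≡ 0#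
  0* = solve 1 (λ x → :0 :* x := :0) refl
  +0 : ∀ x → x + 0# ≡ x
  +0 = solve 1 (λ x → x :+ :0 := x) refl
  0+ : ∀ x → 0# + x ≡ x
  0+ = solve 1 (λ x → :0 :+ x := x) refl
  *1 : ∀ x → x * 1# ≡ x
  *1 = solve 1 (λ x → x :* :1 := x) refl
  1* : ∀ x → 1# * x ≡ x
  1* = solve 1 (λ x → :1 :* x := x) refl

  *0+*0 : ∀ a b → a * 0# + b * 0# ≡ 0#
  *0+*0 = solve 2 (λ a b → a :* :0 :+ b :* :0 := :0) refl

  0*+0* : ∀ a b → 0# * a + 0# * b ≡ 0#
  0*+0* = solve 2 (λ a b → :0 :* a :+ :0 :* b := :0) refl

  *1+*0 : ∀ a b → a * 1# + b * 0# ≡ a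
  *1+*0 = solve 2 (λ a b → a :* :1 :+ b :* :0 := a) refl
  *0+*1 : ∀ a b → a * 0# + b * 1# ≡ b
  *0+*1 = solve 2 (λ a b → a :* :0 :+ b :* :1 := b) refl
  1*+0* : ∀ a b → 1# * a + 0# * b ≡ a
  1*+0* = solve 2 (λ a b → :1 :* a :+ :0 :* b := a) refl
  0*+1* : ∀ a b → 0# * a + 1# * b ≡ b
  0*+1* = solve 2 (λ a b → :0 :* a :+ :1 :* b := b) refl

  1≢0 : 1# ≢ 0#
  1≢0 e = 0≢1 (sym e)

  inv : (x : Carrier) → x ≢ 0# → Carrier
  inv x p = proj₁ (inverse x p)

  inv-l : (x : Carrier) (p : x ≢ 0#) → inv x p * x ≡ 1#
  inv-l x p = trans (*-comm _ _) (proj₂ (inverse x p))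
    where *-comm : ∀ a b → a * b ≡ b * a
          *-comm = solve 2 (λ a b → a :* b := b :* a) refl

  minus0 : ∀ x y → x - y ≡ 0# → x ≡ y
  minus0 x y e = begin
      x                ≡⟨ lem x y ⟩
      (x - y) + y      ≡⟨ cong (_+ y) e ⟩
      0# + y           ≡⟨ 0+ y ⟩
      y ∎
    where open ≡-Reasoning
          lem : ∀ a b → a ≡ (a - b) + b
          lem = solve 2 (λ a b → a := (a :- b) :+ b) refl

  δ-refl : ∀ {n} (i : Fin n) → δ i i ≡ 1#
  δ-refl i with i Fin.≟ i
  ... | yes _ = refl
  ... | no ¬p = ⊥-elim (¬p refl)

  δ-≢ : ∀ {n} (i j : Fin n) → i ≢ j → δ i j ≡ 0#
  δ-≢ i j ne with i Fin.≟ j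
  ... | yes p = ⊥-elim (ne p)
  ... | no _ = refl

  δ-sym : ∀ {n} (i j : Fin n) → δ i j ≡ δ j i
  δ-sym i j with i Fin.≟ j
  ... | yes refl = sym (δ-refl i)
  ... | no ne = sym (δ-≢ j i (λ e → ne (sym e)))

  δ-inj : ∀ {n m} (f : Fin n → Fin m) → (∀ a b → f a ≡ f b → a ≡ b) → ∀ i j → δ (f i) (f j) ≡ δ i j
  δ-inj f finj i j with i Fin.≟ j
  ... | yes refl = δ-refl (f i)
  ... | no ne = δ-≢ (f i) (f j) (λ e → ne (finj i j e))

  δ-suc : ∀ {n} (i j : Fin n) → δ (suc i) (suc j) ≡ δ i j
  δ-suc i j = δ-inj suc (λ a b → FinP.suc-injective) i j

  ∑-cong : ∀ k {f g : Fin k → Carrier} → (∀ i → f i ≡ g i) → ∑ k f ≡ ∑ k g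
  ∑-cong zero e = refl
  ∑-cong (suc k) e = cong₂ _+_ (e zero) (∑-cong k (λ i → e (suc i)))

  ∑-0 : ∀ k {f : Fin k → Carrier} → (∀ i → f i ≡ 0#) → ∑ k f ≡ 0#
  ∑-0 zero e = refl
  ∑-0 (suc k) e = trans (cong₂ _+_ (e zero) (∑-0 k (λ i → e (suc i)))) (+0 0#)

  ∑-+ : ∀ k (f g : Fin k → Carrier) → ∑ k (λ i → f i + g i) ≡ ∑ k f + ∑ k g
  ∑-+ zero f g = sym (+0 0#)
  ∑-+ (suc k) f g = trans (cong (f zero + g zero +_) (∑-+ k _ _)) (lem _ _ _ _)
    where lem : ∀ a b c d → a + b + (c + d) ≡ a + c + (b + d)
          lem = solve 4 (λ a b c d → a :+ b :+ (c :+ d) := a :+ c :+ (b :+ d)) refl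

  ∑-*ˡ : ∀ k a (f : Fin k → Carrier) → a * ∑ k f ≡ ∑ k (λ i → a * f i)
  ∑-*ˡ zero a f = *0 a
  ∑-*ˡ (suc k) a f = trans (lem a _ _) (cong (a * f zero +_) (∑-*ˡ k a _))
    where lem : ∀ a b c → a * (b + c) ≡ a * b + a * c
          lem = solve 3 (λ a b c → a :* (b :+ c) := a :* b :+ a :* c) refl

  ∑-*ʳ : ∀ k a (f : Fin k → Carrier) → ∑ k f * a ≡ ∑ k (λ i → f i * a)
  ∑-*ʳ k a f = trans (lem _ a) (trans (∑-*ˡ k a f) (∑-cong k (λ i → lem a (f i))))
    where lem : ∀ a b → a * b ≡ b * a
          lem = solve 2 (λ a b → a :* b := b :* a) refl

  ∑-neg : ∀ k (f : Fin k → Carrier) → - ∑ k f ≡ ∑ k (λ i → - f i)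
  ∑-neg k f = trans (lem _) (trans (∑-*ˡ k (- 1#) f) (∑-cong k (λ i → sym (lem (f i)))))
    where lem : ∀ a → - a ≡ (- 1#) * a
          lem = solve 1 (λ a → :- a := (:- :1) :* a) refl

  ∑-swap : ∀ k m (f : Fin k → Fin m → Carrier) →
           ∑ k (λ i → ∑ m (λ j → f i j)) ≡ ∑ m (λ j → ∑ k (λ i → f i j))
  ∑-swap zero m f = sym (∑-0 m (λ _ → refl))
  ∑-swap (suc k) m f = trans (cong (∑ m (f zero) +_) (∑-swap k m _))
                             (sym (∑-+ m (f zero) _))

  ∑-δˡ : ∀ k (f : Fin k → Carrier) (j : Fin k) → ∑ k (λ i → f i * δ i j) ≡ f j
  ∑-δˡ (suc k) f zero = trans (cong₂ _+_ (trans (cong (f zero *_) (δ-refl {suc k} zero)) (*1 _))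
                                       (∑-0 k (λ i → trans (cong (f (suc i) *_) (δ-≢ (suc i) zero (λ ()))) (*0 _))))
                              (+0 _)
  ∑-δˡ (suc k) f (suc j) = trans (cong₂ _+_ (trans (cong (f zero *_) (δ-≢ zero (suc j) (λ ()))) (*0 _))
                                         (trans (∑-cong k (λ i → cong (f (suc i) *_) (δ-suc i j)))
                                                (∑-δˡ k (λ i → f (suc i)) j)))
                                (0+ _)

  ∑-δʳ : ∀ k (f : Fin k → Carrier) (j : Fin k) → ∑ k (λ i → δ j i * f i) ≡ f j
  ∑-δʳ k f j = trans (∑-cong k (λ i → trans (*-c _ _) (cong (f i *_) (δ-sym j i)))) (∑-δˡ k f j)
    where *-c : ∀ a b → a * b ≡ b * a
          *-c = solve 2 (λ a b → a :* b := b :* a) refl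

  ∑-punchIn : ∀ k (p : Fin (suc k)) (f : Fin (suc k) → Carrier) →
              ∑ (suc k) f ≡ f p + ∑ k (λ r → f (punchIn p r))
  ∑-punchIn k zero f = refl
  ∑-punchIn (suc k) (suc p) f =
    trans (cong (f zero +_) (∑-punchIn k p (λ i → f (suc i)))) (lem _ _ _)
    where lem : ∀ a b c → a + (b + c) ≡ b + (a + c)
          lem = solve 3 (λ a b c → a :+ (b :+ c) := b :+ (a :+ c)) refl



  infix 4 _≐_
  _≐_ : ∀ {n} → Vect n → Vect n → Set
  v ≐ w = ∀ j → v j ≡ w j

  compose : ∀ {k m n} (d : Fin k → Carrier) (C : Fin k → Fin m → Carrier) (g : Gens m n) →
            lincomb d (λ i → lincomb (C i) g) ≐ lincomb (λ j → ∑ k (λ i → d i * C i j)) g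
  compose {k} {m} d C g x = begin
      ∑ k (λ i → d i * ∑ m (λ j → C i j * g j x))
        ≡⟨ ∑-cong k (λ i → ∑-*ˡ m (d i) _) ⟩
      ∑ k (λ i → ∑ m (λ j → d i * (C i j * g j x)))
        ≡⟨ ∑-swap k m _ ⟩
      ∑ m (λ j → ∑ k (λ i → d i * (C i j * g j x)))
        ≡⟨ ∑-cong m (λ j → trans (∑-cong k (λ i → assoc (d i) (C i j) (g j x))) (sym (∑-*ʳ k (g j x) _))) ⟩
      ∑ m (λ j → ∑ k (λ i → d i * C i j) * g j x) ∎
    where open ≡-Reasoning
          assoc : ∀ a b c → a * (b * c) ≡ (a * b) * c
          assoc = solve 3 (λ a b c → a :* (b :* c) := (a :* b) :* c) refl

  ∈-comb : ∀ {k m n} {v : Vect n} (g : Gens m n) (w : Gens k n) (d : Fin k → Carrier) →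
           (∀ i → w i ∈⟨ g ⟩) → v ≐ lincomb d w → v ∈⟨ g ⟩
  ∈-comb {k} g w d wi e =
    (λ j → ∑ k (λ i → d i * proj₁ (wi i) j)) ,
    (λ x → trans (sym (compose d (λ i → proj₁ (wi i)) g x))
             (trans (∑-cong k (λ i → cong (d i *_) (proj₂ (wi i) x))) (sym (e x))))

  ∈-gen : ∀ {m n} (g : Gens m n) (i : Fin m) → g i ∈⟨ g ⟩
  ∈-gen {m} g i = δ i , (λ x → ∑-δʳ m (λ j → g j x) i)

  ∈-resp : ∀ {m n} {g : Gens m n} {v w : Vect n} → v ≐ w → v ∈⟨ g ⟩ → w ∈⟨ g ⟩
  ∈-resp e (c , p) = c , (λ x → trans (p x) (e x))

  ⊆-gens : ∀ {k m n} {S : Gens m n} {T : Gens k n} → (∀ i → T i ∈⟨ S ⟩) → T ⊆ S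
  ⊆-gens {S = S} {T} Ti v (c , p) = ∈-comb S T c Ti (λ x → sym (p x))

  ⊆-trans : ∀ {k m l n} {A : Gens k n} {B : Gens m n} {C : Gens l n} → A ⊆ B → B ⊆ C → A ⊆ C
  ⊆-trans p q v x = q v (p v x)

  ≈-refl : ∀ {k n} {X : Gens k n} → X ≈ X
  ≈-refl = (λ v x → x) , (λ v x → x)

  ≈-sym : ∀ {a b n} {X : Gens a n} {Y : Gens b n} → X ≈ Y → Y ≈ X
  ≈-sym (a , b) = b , a

  ≈-trans : ∀ {a b c n} {X : Gens a n} {Y : Gens b n} {Z : Gens c n} → X ≈ Y → Y ≈ Z → X ≈ Z
  ≈-trans {X = X} {Y} {Z} (a , b) (c , d) = ⊆-trans {A = X} {B = Y} {C = Z} a c , ⊆-trans {A = Z} {B = Y} {C = X} d b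

  -- Gaussian elimination.  A k × m matrix with m < k has a nonzero vector
  -- in its left kernel; this is the engine of the Steinitz exchange lemma.

  SomeNonzero : ∀ {k} → (Fin k → Carrier) → Set
  SomeNonzero {k} c = Σ (Fin k) λ i → c i ≢ 0#

  LeftKernelVector : ∀ {k m} → (Fin k → Fin m → Carrier) → Set
  LeftKernelVector {k} {m} C =
    Σ (Fin k → Carrier) λ c → (∀ j → ∑ k (λ i → c i * C i j) ≡ 0#) × SomeNonzero c

  allZeroOr : ∀ k (f : Fin k → Carrier) → (∀ i → f i ≡ 0#) ⊎ SomeNonzero f
  allZeroOr zero f = inj₁ (λ ())
  allZeroOr (suc k) f with f zero ≟ 0#
  ... | no ne = inj₂ (zero , ne)
  ... | yes e with allZeroOr k (λ i → f (suc i))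
  ...   | inj₂ (i , ne) = inj₂ (suc i , ne)
  ...   | inj₁ z = inj₁ (λ { zero → e ; (suc i) → z i })

  liftP : ∀ {k} (p : Fin (suc k)) (a : Carrier) (c : Fin k → Carrier) → Fin (suc k) → Carrier
  liftP p a c i with i Fin.≟ p
  ... | yes _ = a
  ... | no ne = c (punchOut (λ e → ne (sym e)))

  liftP-p : ∀ {k} (p : Fin (suc k)) a c → liftP {k} p a c p ≡ a
  liftP-p p a c with p Fin.≟ p
  ... | yes _ = refl
  ... | no ne = ⊥-elim (ne refl)

  liftP-in : ∀ {k} (p : Fin (suc k)) a c r → liftP {k} p a c (punchIn p r) ≡ c r
  liftP-in p a c r with punchIn p r Fin.≟ p
  ... | yes e = ⊥-elim (FinP.punchInᵢ≢i p r e)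
  ... | no ne = cong c (trans (FinP.punchOut-cong p refl) (FinP.punchOut-punchIn p))

  dropZeroColumn : ∀ {k m} (C : Fin k → Fin (suc m) → Carrier) → (∀ i → C i zero ≡ 0#) →
                   LeftKernelVector (λ i j → C i (suc j)) → LeftKernelVector C
  dropZeroColumn {k} C z (c , p , nz) =
    c , (λ { zero → ∑-0 k (λ i → trans (cong (c i *_) (z i)) (*0 _)) ; (suc j) → p j }) , nz

  -- Elimination with the nonzero pivot C p 0: clearing column 0 from the other
  -- rows leaves a k × m matrix, and a left-kernel vector c′ of it lifts to
  -- one of C by giving row p the coefficient -(∑ c′ᵣ C (p↑r) 0) / C p 0.
  eliminate : ∀ {k m} (C : Fin (suc k) → Fin (suc m) → Carrier) (p : Fin (suc k)) (nzp : C p zero ≢ 0#) →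
              LeftKernelVector {k} {m} (λ r j → C (punchIn p r) (suc j) - (C (punchIn p r) zero * inv (C p zero) nzp) * C p (suc j)) →
              LeftKernelVector C
  eliminate {k} C p nzp (c′ , c′-ker , (r0 , nz)) = c , column , (punchIn p r0 , λ e → nz (trans (sym (liftP-in p a c′ r0)) e))
    where
      open ≡-Reasoning
      π = inv (C p zero) nzp
      X = ∑ k (λ r → c′ r * C (punchIn p r) zero)
      a = - (X * π)
      c = liftP p a c′
      split : ∀ j → ∑ (suc k) (λ i → c i * C i j) ≡ a * C p j + ∑ k (λ r → c′ r * C (punchIn p r) j)
      split j = trans (∑-punchIn k p (λ i → c i * C i j))
                      (cong₂ _+_ (cong (_* C p j) (liftP-p p a c′))
                                 (∑-cong k (λ r → cong (_* C (punchIn p r) j) (liftP-in p a c′ r))))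
      reduced : ∀ j → ∑ k (λ r → c′ r * C (punchIn p r) (suc j)) ≡ X * π * C p (suc j)
      reduced j = minus0 _ _ (trans (sym expand) (c′-ker j))
        where
          Y = ∑ k (λ r → c′ r * C (punchIn p r) (suc j))
          expand : ∑ k (λ r → c′ r * (C (punchIn p r) (suc j) - (C (punchIn p r) zero * π) * C p (suc j)))
                   ≡ Y - X * π * C p (suc j)
          expand = begin
              _ ≡⟨ ∑-cong k (λ r → solve 5 (λ c u v p q → c :* (u :- (v :* p) :* q) := c :* u :+ (:- (c :* v)) :* (p :* q)) refl
                                     (c′ r) (C (punchIn p r) (suc j)) (C (punchIn p r) zero) π (C p (suc j))) ⟩
              ∑ k (λ r → c′ r * C (punchIn p r) (suc j) + (- (c′ r * C (punchIn p r) zero)) * (π * C p (suc j)))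
                ≡⟨ ∑-+ k _ _ ⟩
              Y + ∑ k (λ r → (- (c′ r * C (punchIn p r) zero)) * (π * C p (suc j)))
                ≡⟨ cong (Y +_) (sym (∑-*ʳ k _ _)) ⟩
              Y + ∑ k (λ r → - (c′ r * C (punchIn p r) zero)) * (π * C p (suc j))
                ≡⟨ cong (λ t → Y + t * (π * C p (suc j))) (sym (∑-neg k _)) ⟩
              Y + (- X) * (π * C p (suc j))
                ≡⟨ solve 4 (λ y x p q → y :+ (:- x) :* (p :* q) := y :- x :* p :* q) refl Y X π (C p (suc j)) ⟩
              Y - X * π * C p (suc j) ∎
      column : ∀ j → ∑ (suc k) (λ i → c i * C i j) ≡ 0#
      column zero = begin
        ∑ (suc k) (λ i → c i * C i zero)   ≡⟨ split zero ⟩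
        - (X * π) * C p zero + X           ≡⟨ solve 3 (λ x y z → :- (x :* y) :* z :+ x := x :* (:1 :- y :* z)) refl X π (C p zero) ⟩
        X * (1# - π * C p zero)            ≡⟨ cong (λ t → X * (1# - t)) (inv-l (C p zero) nzp) ⟩
        X * (1# - 1#)                      ≡⟨ solve 1 (λ x → x :* (:1 :- :1) := :0) refl X ⟩
        0#                                 ∎
      column (suc j) = begin
        ∑ (suc k) (λ i → c i * C i (suc j))       ≡⟨ split (suc j) ⟩
        a * C p (suc j) + _                       ≡⟨ cong (a * C p (suc j) +_) (reduced j) ⟩
        - (X * π) * C p (suc j) + X * π * C p (suc j)
          ≡⟨ solve 3 (λ x p q → :- (x :* p) :* q :+ x :* p :* q := :0) refl X π (C p (suc j)) ⟩
        0#                                        ∎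

  leftKernel : ∀ m k → m < k → (C : Fin k → Fin m → Carrier) → LeftKernelVector C
  leftKernel zero (suc k) _ C = δ zero , (λ ()) , (zero , λ e → 1≢0 (trans (sym (δ-refl {suc k} zero)) e))
  leftKernel (suc m) (suc k) (s≤s m<k) C with allZeroOr (suc k) (λ i → C i zero)
  ... | inj₁ z        = dropZeroColumn C z (leftKernel m (suc k) (NP.m<n⇒m<1+n m<k) (λ i j → C i (suc j)))
  ... | inj₂ (p , nz) = eliminate C p nz (leftKernel m k m<k _)

  dependentCombination : ∀ {k m n} (w : Gens k n) (v : Gens m n) → m < k → (∀ i → w i ∈⟨ v ⟩) →
                         Σ (Fin k → Carrier) λ c → (∀ x → lincomb c w x ≡ 0#) × SomeNonzero c
  dependentCombination {k} {m} w v m<k wi with leftKernel m k m<k (λ i → proj₁ (wi i))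
  ... | c , p , nz = c , (λ x → trans (∑-cong k (λ i → cong (c i *_) (sym (proj₂ (wi i) x))))
                                  (trans (compose c (λ i → proj₁ (wi i)) v x)
                                     (∑-0 m (λ j → trans (cong (_* v j x) (p j)) (0* _))))) , nz

  steinitz : ∀ {k m n} (w : Gens k n) (v : Gens m n) → m < k → (∀ i → w i ∈⟨ v ⟩) → ¬ LinIndep w
  steinitz w v m<k wi li with dependentCombination w v m<k wi
  ... | c , p , (i , nz) = nz (li c p i)

  indepPair-spans : ∀ {n} (ℓ ℓ′ : Gens 2 n) → LinIndep ℓ′ → ℓ′ ⊆ ℓ → ℓ ⊆ ℓ′
  indepPair-spans ℓ ℓ′ li sub = ⊆-gens {S = ℓ′} {T = ℓ} go
    where
      go : ∀ k → ℓ k ∈⟨ ℓ′ ⟩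
      go k = go2 (dependentCombination {3} {2} (ℓ k ∷ ℓ′ zero ∷ ℓ′ (suc zero) ∷ []) ℓ (s≤s (s≤s (s≤s z≤n)))
                  (λ { zero → ∈-gen ℓ k ; (suc zero) → sub _ (∈-gen ℓ′ zero) ; (suc (suc zero)) → sub _ (∈-gen ℓ′ (suc zero)) }))
        where
        go2 : (Σ (Fin 3 → Carrier) λ c → (∀ x → lincomb c (ℓ k ∷ ℓ′ zero ∷ ℓ′ (suc zero) ∷ []) x ≡ 0#) × SomeNonzero c) → ℓ k ∈⟨ ℓ′ ⟩
        go2 (c , h , (i , nz)) with c zero ≟ 0#
        ... | no c0nz = ((- (κ * c1)) ∷ (- (κ * c2)) ∷ []) , λ x → sym (eq x)
          where
            c1 = c (suc zero)
            c2 = c (suc (suc zero))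
            κ = inv (c zero) c0nz
            eq : ∀ x → ℓ k x ≡ (- (κ * c1)) * ℓ′ zero x + ((- (κ * c2)) * ℓ′ (suc zero) x + 0#)
            eq x = begin
              ℓ k x ≡⟨ sym (1* _) ⟩
              1# * ℓ k x ≡⟨ cong (_* ℓ k x) (sym (inv-l (c zero) c0nz)) ⟩
              κ * c zero * ℓ k x ≡⟨ solve 7 (λ κ c0 c1 c2 a b d → κ :* c0 :* a := κ :* (c0 :* a :+ (c1 :* b :+ (c2 :* d :+ :0))) :+ (:- (κ :* c1)) :* b :+ (:- (κ :* c2)) :* d) refl κ (c zero) c1 c2 (ℓ k x) (ℓ′ zero x) (ℓ′ (suc zero) x) ⟩
              κ * (c zero * ℓ k x + (c1 * ℓ′ zero x + (c2 * ℓ′ (suc zero) x + 0#))) + (- (κ * c1)) * ℓ′ zero x + (- (κ * c2)) * ℓ′ (suc zero) x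
                ≡⟨ cong (λ t → κ * t + (- (κ * c1)) * ℓ′ zero x + (- (κ * c2)) * ℓ′ (suc zero) x) (h x) ⟩
              κ * 0# + (- (κ * c1)) * ℓ′ zero x + (- (κ * c2)) * ℓ′ (suc zero) x
                ≡⟨ solve 5 (λ κ c1 c2 b d → κ :* :0 :+ (:- (κ :* c1)) :* b :+ (:- (κ :* c2)) :* d := (:- (κ :* c1)) :* b :+ ((:- (κ :* c2)) :* d :+ :0)) refl κ c1 c2 (ℓ′ zero x) (ℓ′ (suc zero) x) ⟩
              (- (κ * c1)) * ℓ′ zero x + ((- (κ * c2)) * ℓ′ (suc zero) x + 0#) ∎
              where open ≡-Reasoning
        ... | yes c0z = ⊥-elim (nz (z i))
          where
            zz = li (c (suc zero) ∷ c (suc (suc zero)) ∷ [])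
                    (λ x → trans (sym (trans (cong (λ t → t * ℓ k x + lincomb (c (suc zero) ∷ c (suc (suc zero)) ∷ []) ℓ′ x) c0z)
                                          (trans (cong (_+ lincomb (c (suc zero) ∷ c (suc (suc zero)) ∷ []) ℓ′ x) (0* _)) (0+ _)))) (h x))
            z : ∀ i → c i ≡ 0#
            z zero = c0z
            z (suc zero) = zz zero
            z (suc (suc zero)) = zz (suc zero)

  -- Positions 1-4 ("front", fr) span Σ′ and
  -- positions 5-8 ("back", bk) span Σ; a vector lies in Σ iff its front
  -- vanishes and in Σ′ iff its back vanishes.  Split8 lets proofs treat the
  -- two halves uniformly by pattern matching.

  fr : Fin 4 → Fin 8
  fr j = j ↑ˡ 4
  bk : Fin 4 → Fin 8
  bk j = 4 ↑ʳ j

  fr≢bk : ∀ i j → fr i ≢ bk j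
  fr≢bk zero j ()
  fr≢bk (suc zero) j ()
  fr≢bk (suc (suc zero)) j ()
  fr≢bk (suc (suc (suc zero))) j ()

  bk-inj : ∀ a b → bk a ≡ bk b → a ≡ b
  bk-inj a b e = FinP.↑ʳ-injective 4 a b e
  fr-inj : ∀ a b → fr a ≡ fr b → a ≡ b
  fr-inj a b e = FinP.↑ˡ-injective 4 a b e

  data Split8 : Fin 8 → Set where
    isFr : ∀ j → Split8 (fr j)
    isBk : ∀ j → Split8 (bk j)

  split8 : ∀ x → Split8 x
  split8 zero = isFr zero
  split8 (suc zero) = isFr (suc zero)
  split8 (suc (suc zero)) = isFr (suc (suc zero))
  split8 (suc (suc (suc zero))) = isFr (suc (suc (suc zero)))
  split8 (suc (suc (suc (suc zero)))) = isBk zero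
  split8 (suc (suc (suc (suc (suc zero))))) = isBk (suc zero)
  split8 (suc (suc (suc (suc (suc (suc zero)))))) = isBk (suc (suc zero))
  split8 (suc (suc (suc (suc (suc (suc (suc zero))))))) = isBk (suc (suc (suc zero)))

  InΣ : Vect 8 → Set
  InΣ v = ∀ j → v (fr j) ≡ 0#
  InΣ′ : Vect 8 → Set
  InΣ′ v = ∀ j → v (bk j) ≡ 0#

  ΣsC-fr : ∀ c j → lincomb c Σs (fr j) ≡ 0#
  ΣsC-fr c j = ∑-0 4 (λ i → trans (cong (c i *_) (δ-≢ (bk i) (fr j) (λ e → fr≢bk j i (sym e)))) (*0 _))
  ΣsC-bk : ∀ c j → lincomb c Σs (bk j) ≡ c j
  ΣsC-bk c j = trans (∑-cong 4 (λ i → cong (c i *_) (δ-inj bk bk-inj i j))) (∑-δˡ 4 c j)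
  Σ′C-bk : ∀ c j → lincomb c Σ′ (bk j) ≡ 0#
  Σ′C-bk c j = ∑-0 4 (λ i → trans (cong (c i *_) (δ-≢ (fr i) (bk j) (fr≢bk i j))) (*0 _))
  Σ′C-fr : ∀ c j → lincomb c Σ′ (fr j) ≡ c j
  Σ′C-fr c j = trans (∑-cong 4 (λ i → cong (c i *_) (δ-inj fr fr-inj i j))) (∑-δˡ 4 c j)

  Σ-char→ : ∀ {v} → v ∈⟨ Σs ⟩ → InΣ v
  Σ-char→ (c , p) j = trans (sym (p (fr j))) (ΣsC-fr c j)
  Σ-char← : ∀ {v} → InΣ v → v ∈⟨ Σs ⟩
  Σ-char← {v} h = (λ i → v (bk i)) , λ x → go x (split8 x)
    where go : ∀ x → Split8 x → lincomb (λ i → v (bk i)) Σs x ≡ v x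
          go .(fr j) (isFr j) = trans (ΣsC-fr (λ i → v (bk i)) j) (sym (h j))
          go .(bk j) (isBk j) = ΣsC-bk (λ i → v (bk i)) j
  Σ′-char→ : ∀ {v} → v ∈⟨ Σ′ ⟩ → InΣ′ v
  Σ′-char→ (c , p) j = trans (sym (p (bk j))) (Σ′C-bk c j)
  Σ′-char← : ∀ {v} → InΣ′ v → v ∈⟨ Σ′ ⟩
  Σ′-char← {v} h = (λ i → v (fr i)) , λ x → go x (split8 x)
    where go : ∀ x → Split8 x → lincomb (λ i → v (fr i)) Σ′ x ≡ v x
          go .(bk j) (isBk j) = trans (Σ′C-bk (λ i → v (fr i)) j) (sym (h j))
          go .(fr j) (isFr j) = Σ′C-fr (λ i → v (fr i)) j

  -- Since Σ is the "back",
  -- a vector of Γ_ℓ is determined modulo Σ by its front part, which is a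
  -- combination a·ℓ₀ + b·ℓ₁ of the fronts of the generators of ℓ.

  Γ : Line 8 → Gens 6 8
  Γ ℓ = join Σs ℓ

  joinC : ∀ (ℓ : Line 8) c x → lincomb c (Γ ℓ) x ≡
          lincomb (λ i → c (i ↑ˡ 2)) Σs x + (c (suc (suc (suc (suc zero)))) * ℓ zero x + c (suc (suc (suc (suc (suc zero))))) * ℓ (suc zero) x)
  joinC ℓ c x = solve 6 (λ a0 a1 a2 a3 b b′ → a0 :+ (a1 :+ (a2 :+ (a3 :+ (b :+ (b′ :+ :0)))))
                          := (a0 :+ (a1 :+ (a2 :+ (a3 :+ :0)))) :+ (b :+ b′)) refl _ _ _ _ _ _

  FrontIn : Line 8 → Vect 8 → Carrier → Carrier → Set
  FrontIn ℓ v a b = ∀ j → v (fr j) ≡ a * ℓ zero (fr j) + b * ℓ (suc zero) (fr j)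

  Γ-front : ∀ ℓ {v} → v ∈⟨ Γ ℓ ⟩ → Σ Carrier λ a → Σ Carrier λ b → FrontIn ℓ v a b
  Γ-front ℓ (c , p) = c c4 , c c5 , λ j → trans (sym (p (fr j))) (trans (joinC ℓ c (fr j)) (trans (cong (_+ (c c4 * ℓ zero (fr j) + c c5 * ℓ (suc zero) (fr j))) (ΣsC-fr (λ i → c (i ↑ˡ 2)) j)) (0+ _)))
    where c4 c5 : Fin 6
          c4 = suc (suc (suc (suc zero)))
          c5 = suc (suc (suc (suc (suc zero))))

  IsLine′ : Line 8 → Set
  IsLine′ ℓ = InΣ′ (ℓ zero) × InΣ′ (ℓ (suc zero))

  Γ-intro : ∀ ℓ → IsLine′ ℓ → ∀ {v} a b → FrontIn ℓ v a b → v ∈⟨ Γ ℓ ⟩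
  Γ-intro ℓ (h0 , h1) {v} a b fi = c , λ x → trans (joinC ℓ c x) (go x (split8 x))
    where
      ab : Fin 2 → Carrier
      ab zero = a
      ab (suc _) = b
      c : Fin 6 → Carrier
      c i = [ (λ i → v (bk i)) , ab ]′ (splitAt 4 i)
      go : ∀ x → Split8 x → lincomb (λ i → c (i ↑ˡ 2)) Σs x + (a * ℓ zero x + b * ℓ (suc zero) x) ≡ v x
      go .(fr j) (isFr j) = trans (cong (_+ (a * ℓ zero (fr j) + b * ℓ (suc zero) (fr j))) (ΣsC-fr (λ i → c (i ↑ˡ 2)) j)) (trans (0+ _) (sym (fi j)))
      go .(bk j) (isBk j) = trans (cong₂ _+_ (trans (ΣsC-bk (λ i → c (i ↑ˡ 2)) j) (cong ([ (λ i → v (bk i)) , ab ]′) (FinP.splitAt-↑ˡ 4 j 2)))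
                                              (trans (cong₂ (λ s t → a * s + b * t) (h0 j) (h1 j)) (*0+*0 a b)))
                                  (+0 _)

  Σ⊆Γ : ∀ ℓ → IsLine′ ℓ → ∀ {v} → v ∈⟨ Σs ⟩ → v ∈⟨ Γ ℓ ⟩
  Σ⊆Γ ℓ hl {v} vΣ = Γ-intro ℓ hl 0# 0# λ j → trans (Σ-char→ vΣ j) (sym (trans (cong₂ _+_ (0* _) (0* _)) (+0 0#)))

  ℓ⊆Γ : ∀ (ℓ : Line 8) → ℓ ⊆ Γ ℓ
  ℓ⊆Γ ℓ = ⊆-gens {S = Γ ℓ} {T = ℓ} λ
    { zero → ∈-gen (Γ ℓ) (suc (suc (suc (suc zero))))
    ; (suc zero) → ∈-gen (Γ ℓ) (suc (suc (suc (suc (suc zero))))) }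

  Γ⊆ : ∀ {k} {W : Gens k 8} (ℓ : Line 8) → Σs ⊆ W → ℓ ⊆ W → Γ ℓ ⊆ W
  Γ⊆ {W = W} ℓ Σ⊆W ℓ⊆W = ⊆-gens {S = W} {T = Γ ℓ} generator
    where
      generator : ∀ i → [ Σs , ℓ ]′ (splitAt 4 i) ∈⟨ W ⟩
      generator i with splitAt 4 i
      ... | inj₁ a = Σ⊆W _ (∈-gen Σs a)
      ... | inj₂ b = ℓ⊆W _ (∈-gen ℓ b)

  Γ-mono : ∀ (ℓ ℓ′ : Line 8) → IsLine′ ℓ′ → ℓ ⊆ ℓ′ → Γ ℓ ⊆ Γ ℓ′
  Γ-mono ℓ ℓ′ h sub = Γ⊆ {W = Γ ℓ′} ℓ (λ v → Σ⊆Γ ℓ′ h) (⊆-trans {A = ℓ} {B = ℓ′} {C = Γ ℓ′} sub (ℓ⊆Γ ℓ′))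

  -- We need: for two vectors x, y ∈ F⁴, either they are
  -- independent – witnessed by d, e with (d·x, d·y) = (1,0), (e·x, e·y) = (0,1) –
  -- or they have three independent common annihilators.

  dot : ∀ {k} → (Fin k → Carrier) → (Fin k → Carrier) → Carrier
  dot {k} a b = ∑ k (λ i → a i * b i)

  dot-δ : ∀ {n} (a : Fin n) (w : Fin n → Carrier) → dot (δ a) w ≡ w a
  dot-δ {n} a w = ∑-δʳ n w a

  dot-scale : ∀ {k} a (u w : Fin k → Carrier) → dot (λ i → a * u i) w ≡ a * dot u w
  dot-scale {k} a u w = trans (∑-cong k (λ i → solve 3 (λ a b c → (a :* b) :* c := a :* (b :* c)) refl a (u i) (w i))) (sym (∑-*ˡ k a (λ i → u i * w i)))

  dot-lin : ∀ {k} a b (u v w : Fin k → Carrier) → dot (λ i → a * u i + b * v i) w ≡ a * dot u w + b * dot v w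
  dot-lin {k} a b u v w = trans (∑-cong k (λ i → solve 5 (λ a b u v w → (a :* u :+ b :* v) :* w := a :* (u :* w) :+ b :* (v :* w)) refl a b (u i) (v i) (w i)))
                           (trans (∑-+ k (λ i → a * (u i * w i)) (λ i → b * (v i * w i))) (cong₂ _+_ (sym (∑-*ˡ k a (λ i → u i * w i))) (sym (∑-*ˡ k b (λ i → v i * w i)))))

  shear : ∀ {n} (p : Fin (suc n)) (λs : Fin n → Carrier) → Fin n → Fin (suc n) → Carrier
  shear p λs r k = δ (punchIn p r) k - λs r * δ p k

  shear-dot : ∀ {n} p λs r (w : Fin (suc n) → Carrier) → dot (shear p λs r) w ≡ w (punchIn p r) - λs r * w p
  shear-dot {n} p λs r w = begin
      ∑ (suc n) (λ k → (δ (punchIn p r) k - λs r * δ p k) * w k)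
        ≡⟨ ∑-cong (suc n) (λ k → solve 4 (λ a l b x → (a :- l :* b) :* x := a :* x :+ (:- l) :* (b :* x)) refl (δ (punchIn p r) k) (λs r) (δ p k) (w k)) ⟩
      ∑ (suc n) (λ k → δ (punchIn p r) k * w k + (- λs r) * (δ p k * w k))
        ≡⟨ ∑-+ (suc n) (λ k → δ (punchIn p r) k * w k) (λ k → (- λs r) * (δ p k * w k)) ⟩
      dot (δ (punchIn p r)) w + ∑ (suc n) (λ k → (- λs r) * (δ p k * w k))
        ≡⟨ cong₂ _+_ (dot-δ (punchIn p r) w) (sym (∑-*ˡ (suc n) (- λs r) (λ k → δ p k * w k))) ⟩
      w (punchIn p r) + (- λs r) * dot (δ p) w
        ≡⟨ cong (λ t → w (punchIn p r) + (- λs r) * t) (dot-δ p w) ⟩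
      w (punchIn p r) + (- λs r) * w p
        ≡⟨ solve 3 (λ a l b → a :+ (:- l) :* b := a :- l :* b) refl (w (punchIn p r)) (λs r) (w p) ⟩
      w (punchIn p r) - λs r * w p ∎
    where open ≡-Reasoning

  IndependentRows : ∀ {n m} → (Fin m → Fin n → Carrier) → Set
  IndependentRows {n} {m} c = ∀ (a : Fin m → Carrier) → (∀ k → ∑ m (λ r → a r * c r k) ≡ 0#) → ∀ r → a r ≡ 0#

  -- the shears are independent: their entries at the positions p↑r form δ
  shear-indep : ∀ {n} p λs → IndependentRows {suc n} {n} (shear p λs)
  shear-indep {n} p λs a h r′ = begin
      a r′ ≡⟨ sym (∑-δˡ n a r′) ⟩
      ∑ n (λ r → a r * δ r r′) ≡⟨ ∑-cong n (λ r → cong (a r *_) (sym (entry {r}))) ⟩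
      ∑ n (λ r → a r * shear p λs r (punchIn p r′)) ≡⟨ h (punchIn p r′) ⟩
      0# ∎
    where
      open ≡-Reasoning
      entry : ∀ {r} → shear p λs r (punchIn p r′) ≡ δ r r′
      entry {r} = begin
        δ (punchIn p r) (punchIn p r′) - λs r * δ p (punchIn p r′)
          ≡⟨ cong₂ (λ a b → a - λs r * b) (δ-inj (punchIn p) (FinP.punchIn-injective p) r r′)
                                          (δ-≢ p (punchIn p r′) (λ e → FinP.punchInᵢ≢i p r′ (sym e))) ⟩
        δ r r′ - λs r * 0# ≡⟨ solve 2 (λ a b → a :- b :* :0 := a) refl (δ r r′) (λs r) ⟩
        δ r r′ ∎

  pivotRatios : ∀ {n} (x : Fin (suc n) → Carrier) (p : Fin (suc n)) → x p ≢ 0# → Fin n → Carrier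
  pivotRatios x p nz r = x (punchIn p r) * inv (x p) nz

  pivotShear : ∀ {n} (x : Fin (suc n) → Carrier) (p : Fin (suc n)) → x p ≢ 0# → Fin n → Fin (suc n) → Carrier
  pivotShear x p nz = shear p (pivotRatios x p nz)

  pivotShear-annihilates : ∀ {n} (x : Fin (suc n) → Carrier) p (nz : x p ≢ 0#) r → dot (pivotShear x p nz r) x ≡ 0#
  pivotShear-annihilates x p nz r = begin
      dot (pivotShear x p nz r) x                  ≡⟨ shear-dot p (pivotRatios x p nz) r x ⟩
      x (punchIn p r) - x (punchIn p r) * π * x p  ≡⟨ cong (λ t → x (punchIn p r) - t) (assoc (x (punchIn p r)) π (x p)) ⟩
      x (punchIn p r) - x (punchIn p r) * (π * x p) ≡⟨ cong (λ t → x (punchIn p r) - x (punchIn p r) * t) (inv-l (x p) nz) ⟩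
      x (punchIn p r) - x (punchIn p r) * 1#       ≡⟨ solve 1 (λ a → a :- a :* :1 := :0) refl (x (punchIn p r)) ⟩
      0#                                           ∎
    where open ≡-Reasoning
          π = inv (x p) nz
          assoc : ∀ a b c → a * b * c ≡ a * (b * c)
          assoc = solve 3 (λ a b c → a :* b :* c := a :* (b :* c)) refl

  shear-zero : ∀ {n} (p : Fin (suc n)) λs r (w : Fin (suc n) → Carrier) → (∀ i → w i ≡ 0#) → dot (shear p λs r) w ≡ 0#
  shear-zero p λs r w wz = trans (shear-dot p λs r w)
    (trans (cong₂ (λ a b → a - λs r * b) (wz (punchIn p r)) (wz p)) (solve 1 (λ a → :0 :- a :* :0 := :0) refl (λs r)))

  record DualPair (x y : Fin 4 → Carrier) : Set where
    field
      d e : Fin 4 → Carrier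
      dx : dot d x ≡ 1#
      dy : dot d y ≡ 0#
      ex : dot e x ≡ 0#
      ey : dot e y ≡ 1#

  record CommonAnnihilator (x y : Fin 4 → Carrier) : Set where
    field
      c : Fin 3 → Fin 4 → Carrier
      cx : ∀ r → dot (c r) x ≡ 0#
      cy : ∀ r → dot (c r) y ≡ 0#
      ind : IndependentRows c

  -- x ≠ 0 with pivot p, and some shear annihilating x does not annihilate y:
  -- normalising that shear gives e, and d = e_p / x_p corrected by e
  dualPair : (x y : Fin 4 → Carrier) (p : Fin 4) (nz : x p ≢ 0#) (r0 : Fin 3) →
             dot (pivotShear x p nz r0) y ≢ 0# → DualPair x y
  dualPair x y p nz r0 y′≢0 = record { d = d ; e = e ; dx = dx ; dy = dy ; ex = ex ; ey = ey }
    where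
      π = inv (x p) nz
      y′ = dot (pivotShear x p nz r0) y
      ρ = inv y′ y′≢0
      e = λ k → ρ * pivotShear x p nz r0 k
      d = λ k → π * δ p k + (- (y p * π)) * e k
      ex : dot e x ≡ 0#
      ex = trans (dot-scale ρ (pivotShear x p nz r0) x) (trans (cong (ρ *_) (pivotShear-annihilates x p nz r0)) (*0 ρ))
      ey : dot e y ≡ 1#
      ey = trans (dot-scale ρ (pivotShear x p nz r0) y) (inv-l y′ y′≢0)
      dx : dot d x ≡ 1#
      dx = trans (dot-lin π (- (y p * π)) (δ p) e x)
             (trans (cong₂ (λ a b → π * a + (- (y p * π)) * b) (dot-δ p x) ex)
               (trans (cong (_+ (- (y p * π)) * 0#) (inv-l (x p) nz))
                 (solve 1 (λ a → :1 :+ a :* :0 := :1) refl (- (y p * π)))))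
      dy : dot d y ≡ 0#
      dy = trans (dot-lin π (- (y p * π)) (δ p) e y)
             (trans (cong₂ (λ a b → π * a + (- (y p * π)) * b) (dot-δ p y) ey)
               (solve 2 (λ a b → a :* b :+ (:- (b :* a)) :* :1 := :0) refl π (y p)))

  dualPairOrAnnihilator : (x y : Fin 4 → Carrier) → DualPair x y ⊎ CommonAnnihilator x y
  dualPairOrAnnihilator x y with allZeroOr 4 x
  ... | inj₂ (p , nz) with allZeroOr 3 (λ r → dot (pivotShear x p nz r) y)
  ...   | inj₂ (r0 , y′≢0) = inj₁ (dualPair x y p nz r0 y′≢0)
  ...   | inj₁ z = inj₂ (record { c = pivotShear x p nz ; cx = pivotShear-annihilates x p nz ; cy = z
                                ; ind = shear-indep p (pivotRatios x p nz) })
  dualPairOrAnnihilator x y | inj₁ xz with allZeroOr 4 y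
  ... | inj₂ (p , nz) = inj₂ (record { c = pivotShear y p nz ; cx = λ r → shear-zero p (pivotRatios y p nz) r x xz
                                     ; cy = pivotShear-annihilates y p nz ; ind = shear-indep p (pivotRatios y p nz) })
  ... | inj₁ yz = inj₂ (record { c = shear zero (λ _ → 0#) ; cx = λ r → shear-zero zero (λ _ → 0#) r x xz
                               ; cy = λ r → shear-zero zero (λ _ → 0#) r y yz ; ind = shear-indep zero (λ _ → 0#) })

  front-lincomb : ∀ (ℓ : Line 8) (S : Solid 8) (x y : Fin 4 → Carrier) → (∀ k → FrontIn ℓ (S k) (x k) (y k)) →
                  ∀ d → FrontIn ℓ (lincomb d S) (dot d x) (dot d y)
  front-lincomb ℓ S x y h d j = begin
      ∑ 4 (λ k → d k * S k (fr j))
        ≡⟨ ∑-cong 4 (λ k → trans (cong (d k *_) (h k j)) (distrib (d k) (x k) (y k) a b)) ⟩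
      ∑ 4 (λ k → (d k * x k) * a + (d k * y k) * b)
        ≡⟨ ∑-+ 4 (λ k → (d k * x k) * a) (λ k → (d k * y k) * b) ⟩
      ∑ 4 (λ k → (d k * x k) * a) + ∑ 4 (λ k → (d k * y k) * b)
        ≡⟨ cong₂ _+_ (sym (∑-*ʳ 4 a (λ k → d k * x k))) (sym (∑-*ʳ 4 b (λ k → d k * y k))) ⟩
      dot d x * a + dot d y * b ∎
    where
      open ≡-Reasoning
      a = ℓ zero (fr j)
      b = ℓ (suc zero) (fr j)
      distrib : ∀ d x y a b → d * (x * a + y * b) ≡ (d * x) * a + (d * y) * b
      distrib = solve 5 (λ d x y a b → d :* (x :* a :+ y :* b) := (d :* x) :* a :+ (d :* y) :* b) refl

  lincomb-indep : ∀ {m} (S : Solid 8) (c : Fin m → Fin 4 → Carrier) → LinIndep S → IndependentRows c →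
                  LinIndep {m} {8} (λ r → lincomb (c r) S)
  lincomb-indep {m} S c liS ic a h = ic a (liS _ (λ x → trans (sym (compose a c S x)) (h x)))

  record FrontBasis (ℓ : Line 8) (S : Solid 8) : Set where
    field
      s t : Vect 8
      s∈ : s ∈⟨ S ⟩
      t∈ : t ∈⟨ S ⟩
      sF : FrontIn ℓ s 1# 0#
      tF : FrontIn ℓ t 0# 1#

  -- A solid S ⊆ Γ_ℓ whose intersection with Σ lies in a line m
  -- has a front basis: otherwise the front coefficients x, y of its
  -- generators have three independent common annihilators, which yield
  -- three independent vectors of S with zero front, i.e. of S ∩ Σ ⊆ m,
  -- contradicting Steinitz.
  opaque
    frontBasis : (ℓ : Line 8) (S : Solid 8) (m : Line 8) → LinIndep S → S ⊆ Γ ℓ →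
                 (∀ v → v ∈⟨ S ⟩ → InΣ v → v ∈⟨ m ⟩) → FrontBasis ℓ S
    frontBasis ℓ S m liS S⊆ SΣ = fromEither (dualPairOrAnnihilator x y)
      where
        frontOf : ∀ k → Σ Carrier λ a → Σ Carrier λ b → FrontIn ℓ (S k) a b
        frontOf k = Γ-front ℓ (S⊆ (S k) (∈-gen S k))
        x y : Fin 4 → Carrier
        x k = proj₁ (frontOf k)
        y k = proj₁ (proj₂ (frontOf k))
        front : ∀ d → FrontIn ℓ (lincomb d S) (dot d x) (dot d y)
        front = front-lincomb ℓ S x y (λ k → proj₂ (proj₂ (frontOf k)))
        withFront : ∀ d {a b} → dot d x ≡ a → dot d y ≡ b → FrontIn ℓ (lincomb d S) a b
        withFront d refl refl = front d

        fromEither : DualPair x y ⊎ CommonAnnihilator x y → FrontBasis ℓ S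
        fromEither (inj₁ g) = record
          { s = lincomb d S ; t = lincomb e S
          ; s∈ = ∈-comb S S d (∈-gen S) (λ _ → refl) ; t∈ = ∈-comb S S e (∈-gen S) (λ _ → refl)
          ; sF = withFront d dx dy ; tF = withFront e ex ey }
          where open DualPair g
        fromEither (inj₂ b) = ⊥-elim (steinitz {3} {2} w m (s≤s (s≤s (s≤s z≤n))) w∈m (lincomb-indep S c liS ind))
          where
            open CommonAnnihilator b
            w : Gens 3 8
            w r = lincomb (c r) S
            w∈m : ∀ r → w r ∈⟨ m ⟩
            w∈m r = SΣ (w r) (∈-comb S S (c r) (∈-gen S) (λ _ → refl))
                       (λ j → trans (withFront (c r) (cx r) (cy r) j) (0*+0* (ℓ zero (fr j)) (ℓ (suc zero) (fr j))))

  -- A line m of Σ has a basis n₁, n₂ in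
  -- reduced echelon form with respect to two back coordinates p and
  -- p′ = p↑q: n₁ = 1, 0 and n₂ = 0, 1 there.  The remaining two back
  -- coordinates are p↑(q↑r), r ∈ {0,1}; Cover lists the four cases.

  data Cover (p : Fin 4) (q : Fin 3) : Fin 4 → Set where
    cP  : Cover p q p
    cP′ : Cover p q (punchIn p q)
    cA  : ∀ r → Cover p q (punchIn p (punchIn q r))

  cover : ∀ p q j → Cover p q j
  cover p q j with j Fin.≟ p
  ... | yes refl = cP
  ... | no j≢p with punchOut (λ e → j≢p (sym e)) Fin.≟ q
  ...   | yes e = subst (Cover p q) (trans (cong (punchIn p) (sym e)) (FinP.punchIn-punchOut (λ e → j≢p (sym e)))) cP′
  ...   | no o≢q = subst (Cover p q) (trans (cong (punchIn p) (FinP.punchIn-punchOut (λ e → o≢q (sym e))))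
                                              (FinP.punchIn-punchOut (λ e → j≢p (sym e)))) (cA (punchOut (λ e → o≢q (sym e))))

  lc2 : Carrier → Carrier → Vect 8 → Vect 8 → Vect 8
  lc2 a b u v j = a * u j + b * v j

  lc2∈ : ∀ (m : Line 8) a b → lc2 a b (m zero) (m (suc zero)) ∈⟨ m ⟩
  lc2∈ m a b = (a ∷ b ∷ []) , (λ x → cong (a * m zero x +_) (+0 _))

  mkLine : Vect 8 → Vect 8 → Line 8
  mkLine u v = u ∷ v ∷ []

  record EchelonBasis (m : Line 8) : Set where
    field
      p : Fin 4
      q : Fin 3
      n1 n2 : Vect 8
      n1Σ : InΣ n1
      n2Σ : InΣ n2
      n1p : n1 (bk p) ≡ 1#
      n1p′ : n1 (bk (punchIn p q)) ≡ 0#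
      n2p : n2 (bk p) ≡ 0#
      n2p′ : n2 (bk (punchIn p q)) ≡ 1#
      n⊆m : mkLine n1 n2 ⊆ m
      m⊆n : m ⊆ mkLine n1 n2

  lc2Σ : ∀ a b u v → InΣ u → InΣ v → InΣ (lc2 a b u v)
  lc2Σ a b u v hu hv j = trans (cong₂ (λ s t → a * s + b * t) (hu j) (hv j))
                           (*0+*0 a b)

  zeroVec : ∀ {v : Vect 8} → InΣ v → (∀ j → v (bk j) ≡ 0#) → ∀ x → v x ≡ 0#
  zeroVec {v} hf hb x with split8 x
  ... | isFr j = hf j
  ... | isBk j = hb j

  module _ (m : Line 8) (li : LinIndep m) (h0 : InΣ (m zero)) (h1 : InΣ (m (suc zero))) where
    private
      m0 = m zero
      m1 = m (suc zero)

      dep : ∀ a b → b ≢ 0# ⊎ a ≢ 0# → (∀ x → a * m0 x + b * m1 x ≡ 0#) → ⊥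
      dep a b nz h with li (a ∷ b ∷ []) (λ x → trans (cong (a * m0 x +_) (+0 _)) (h x))
      ... | z with nz
      ...   | inj₁ bnz = bnz (z (suc zero))
      ...   | inj₂ anz = anz (z zero)

      -- with m₀ having the nonzero entry x at the back coordinate p, the
      -- vector m₂′ = m₁ - (y/x) m₀ (y = m₁ at p) vanishes at p; it has a
      -- nonzero back entry elsewhere, at some p↑q, since m₀, m₁ are independent
      secondPivot : (p : Fin 4) (x : Carrier) (xnz : x ≢ 0#) → m0 (bk p) ≡ x →
                    SomeNonzero (λ r → lc2 (- (m1 (bk p) * inv x xnz)) 1# m0 m1 (bk (punchIn p r)))
      secondPivot p x xnz ex with allZeroOr 3 (λ r → m2′ (bk (punchIn p r)))
        where π = inv x xnz
              y = m1 (bk p)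
              m2′ = lc2 (- (y * π)) 1# m0 m1
      ... | inj₂ found = found
      ... | inj₁ allz = ⊥-elim (dep (- (y * π)) 1# (inj₁ 1≢0) (zeroVec (lc2Σ _ _ m0 m1 h0 h1) bz))
        where π = inv x xnz
              y = m1 (bk p)
              m2′ = lc2 (- (y * π)) 1# m0 m1
              bz : ∀ j → m2′ (bk j) ≡ 0#
              bz j with cover p zero j
              ... | cP = begin
                   - (y * π) * m0 (bk p) + 1# * y ≡⟨ cong (λ t → - (y * π) * t + 1# * y) ex ⟩
                   - (y * π) * x + 1# * y ≡⟨ solve 3 (λ y π x → :- (y :* π) :* x :+ :1 :* y := y :* (:1 :- π :* x)) refl y π x ⟩
                   y * (1# - π * x) ≡⟨ cong (λ t → y * (1# - t)) (inv-l x xnz) ⟩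
                   y * (1# - 1#) ≡⟨ solve 1 (λ y → y :* (:1 :- :1) := :0) refl y ⟩
                   0# ∎
                where open ≡-Reasoning
              ... | cP′ = allz zero
              ... | cA r = allz (suc r)

    -- normalising m₂′ at p↑q and clearing that column from m₀/x gives the basis
    module FromPivots (p : Fin 4) (x : Carrier) (xnz : x ≢ 0#) (ex : m0 (bk p) ≡ x) (q : Fin 3)
                      (znz : lc2 (- (m1 (bk p) * inv x xnz)) 1# m0 m1 (bk (punchIn p q)) ≢ 0#) where
      π y z ζ w a1 b1 a2 b2 : Carrier
      p′ : Fin 8
      π = inv x xnz
      y = m1 (bk p)
      p′ = bk (punchIn p q)
      z = - (y * π) * m0 p′ + 1# * m1 p′
      ζ = inv z znz
      w = π * m0 p′
      a2 = ζ * (- (y * π))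
      b2 = ζ * 1#
      a1 = π + (- w) * a2
      b1 = (- w) * b2
      n1 n2 : Vect 8
      n1 = lc2 a1 b1 m0 m1
      n2 = lc2 a2 b2 m0 m1
      πx : π * x ≡ 1#
      πx = inv-l x xnz
      ζz : ζ * z ≡ 1#
      ζz = inv-l z znz
      open ≡-Reasoning
      n2p : n2 (bk p) ≡ 0#
      n2p = begin
        a2 * m0 (bk p) + b2 * y ≡⟨ cong (λ t → a2 * t + b2 * y) ex ⟩
        ζ * (- (y * π)) * x + ζ * 1# * y ≡⟨ solve 4 (λ ζ y π x → ζ :* (:- (y :* π)) :* x :+ ζ :* :1 :* y := ζ :* y :* (:1 :- π :* x)) refl ζ y π x ⟩
        ζ * y * (1# - π * x) ≡⟨ cong (λ t → ζ * y * (1# - t)) πx ⟩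
        ζ * y * (1# - 1#) ≡⟨ solve 2 (λ a b → a :* b :* (:1 :- :1) := :0) refl ζ y ⟩
        0# ∎
      n2p′ : n2 p′ ≡ 1#
      n2p′ = begin
        ζ * (- (y * π)) * m0 p′ + ζ * 1# * m1 p′ ≡⟨ solve 5 (λ ζ y π a b → ζ :* (:- (y :* π)) :* a :+ ζ :* :1 :* b := ζ :* ((:- (y :* π)) :* a :+ :1 :* b)) refl ζ y π (m0 p′) (m1 p′) ⟩
        ζ * z ≡⟨ ζz ⟩
        1# ∎
      n1-def : ∀ t → n1 t ≡ π * m0 t + (- w) * n2 t
      n1-def t = solve 6 (λ π w a2 b2 a b → (π :+ (:- w) :* a2) :* a :+ (:- w) :* b2 :* b := π :* a :+ (:- w) :* (a2 :* a :+ b2 :* b)) refl π w a2 b2 (m0 t) (m1 t)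
      n1p : n1 (bk p) ≡ 1#
      n1p = begin
        n1 (bk p) ≡⟨ n1-def (bk p) ⟩
        π * m0 (bk p) + (- w) * n2 (bk p) ≡⟨ cong₂ (λ s t → π * s + (- w) * t) ex n2p ⟩
        π * x + (- w) * 0# ≡⟨ cong (_+ (- w) * 0#) πx ⟩
        1# + (- w) * 0# ≡⟨ solve 1 (λ w → :1 :+ w :* :0 := :1) refl (- w) ⟩
        1# ∎
      n1p′ : n1 p′ ≡ 0#
      n1p′ = begin
        n1 p′ ≡⟨ n1-def p′ ⟩
        π * m0 p′ + (- w) * n2 p′ ≡⟨ cong (λ t → π * m0 p′ + (- w) * t) n2p′ ⟩
        π * m0 p′ + (- w) * 1# ≡⟨ solve 2 (λ π a → π :* a :+ (:- (π :* a)) :* :1 := :0) refl π (m0 p′) ⟩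
        0# ∎
      m0eq : ∀ t → lincomb (x ∷ (x * w) ∷ []) (mkLine n1 n2) t ≡ m0 t
      m0eq t = begin
        x * n1 t + (x * w * n2 t + 0#) ≡⟨ cong (λ s → x * s + (x * w * n2 t + 0#)) (n1-def t) ⟩
        x * (π * m0 t + (- w) * n2 t) + (x * w * n2 t + 0#)
          ≡⟨ solve 5 (λ x π a w n → x :* (π :* a :+ (:- w) :* n) :+ (x :* w :* n :+ :0) := (π :* x) :* a) refl x π (m0 t) w (n2 t) ⟩
        (π * x) * m0 t ≡⟨ cong (_* m0 t) πx ⟩
        1# * m0 t ≡⟨ 1* _ ⟩
        m0 t ∎
      m1eq : ∀ t → lincomb (y ∷ (z + y * w) ∷ []) (mkLine n1 n2) t ≡ m1 t
      m1eq t = begin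
        y * n1 t + ((z + y * w) * n2 t + 0#) ≡⟨ cong (λ s → y * s + ((z + y * w) * n2 t + 0#)) (n1-def t) ⟩
        y * (π * m0 t + (- w) * n2 t) + ((z + y * w) * n2 t + 0#)
          ≡⟨ solve 7 (λ y π a w z ζ b → y :* (π :* a :+ (:- w) :* (ζ :* (:- (y :* π)) :* a :+ ζ :* :1 :* b)) :+ ((z :+ y :* w) :* (ζ :* (:- (y :* π)) :* a :+ ζ :* :1 :* b) :+ :0)
                            := y :* π :* a :+ (ζ :* z) :* ((:- (y :* π)) :* a :+ b)) refl y π (m0 t) w z ζ (m1 t) ⟩
        y * π * m0 t + (ζ * z) * ((- (y * π)) * m0 t + m1 t) ≡⟨ cong (λ s → y * π * m0 t + s * ((- (y * π)) * m0 t + m1 t)) ζz ⟩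
        y * π * m0 t + 1# * ((- (y * π)) * m0 t + m1 t)
          ≡⟨ solve 4 (λ y π a b → y :* π :* a :+ :1 :* ((:- (y :* π)) :* a :+ b) := b) refl y π (m0 t) (m1 t) ⟩
        m1 t ∎

      basis : EchelonBasis m
      basis = record
          { p = p ; q = q ; n1 = n1 ; n2 = n2
          ; n1Σ = lc2Σ a1 b1 m0 m1 h0 h1 ; n2Σ = lc2Σ a2 b2 m0 m1 h0 h1
          ; n1p = n1p ; n1p′ = n1p′ ; n2p = n2p ; n2p′ = n2p′
          ; n⊆m = ⊆-gens {S = m} {T = mkLine n1 n2} (λ { zero → lc2∈ m a1 b1 ; (suc zero) → lc2∈ m a2 b2 })
          ; m⊆n = ⊆-gens {S = mkLine n1 n2} {T = m} (λ { zero → (x ∷ (x * w) ∷ []) , m0eq ; (suc zero) → (y ∷ (z + y * w) ∷ []) , m1eq }) }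

    opaque
      echelonBasis : EchelonBasis m
      echelonBasis with allZeroOr 4 (λ j → m0 (bk j))
      ... | inj₂ (p , nz) with secondPivot p (m0 (bk p)) nz refl
      ...   | q , znz = FromPivots.basis p (m0 (bk p)) nz refl q znz
      echelonBasis | inj₁ allz = ⊥-elim (dep 1# 0# (inj₂ 1≢0) (λ t → trans (cong₂ _+_ (1* _) (0* _)) (trans (+0 _) (zeroVec h0 allz t))))



  -- Fix a line ℓ = ⟨u₀, u₁⟩ of Σ′
  -- and a line m of Σ with echelon basis n₁, n₂ (pivots p, p′).  With e₀, e₁
  -- the unit vectors at the two non-pivot back coordinates, for every
  -- α = (A₀, A₁, B₀, B₁) ∈ F⁴ we set
  --     Φ α = ⟨ n₁, n₂, u₀ + A₀e₀ + A₁e₁, u₁ + B₀e₀ + B₁e₁ ⟩.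
  -- These are q⁴ distinct solids of Γ_ℓ meeting Σ exactly in m, and every
  -- solid of Γ_ℓ meeting Σ exactly in m is one of them.

  C4 : Set
  C4 = Carrier × Carrier × Carrier × Carrier

  module LineOf (ℓ : Line 8) (liℓ : LinIndep ℓ) (hℓ : IsLine′ ℓ) where
    u0 = ℓ zero
    u1 = ℓ (suc zero)

    frontEq : ∀ a b a′ b′ → (∀ j → a * u0 (fr j) + b * u1 (fr j) ≡ a′ * u0 (fr j) + b′ * u1 (fr j)) → a ≡ a′ × b ≡ b′
    frontEq a b a′ b′ h = minus0 a a′ (z zero) , minus0 b b′ (z (suc zero))
      where
        go : ∀ t → Split8 t → (a - a′) * u0 t + (b - b′) * u1 t ≡ 0#
        go .(fr j) (isFr j) = trans (solve 6 (λ a b a′ b′ u v → (a :- a′) :* u :+ (b :- b′) :* v := (a :* u :+ b :* v) :- (a′ :* u :+ b′ :* v)) refl a b a′ b′ (u0 (fr j)) (u1 (fr j)))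
                                   (trans (cong (λ s → s - (a′ * u0 (fr j) + b′ * u1 (fr j))) (h j)) (solve 1 (λ s → s :- s := :0) refl _))
        go .(bk j) (isBk j) = trans (cong₂ (λ s t → (a - a′) * s + (b - b′) * t) (proj₁ hℓ j) (proj₂ hℓ j))
                                   (*0+*0 (a - a′) (b - b′))
        z = liℓ ((a - a′) ∷ (b - b′) ∷ []) (λ t → trans (cong ((a - a′) * u0 t +_) (+0 _)) (go t (split8 t)))

    front∈ℓ : ∀ {w : Vect 8} a b → InΣ′ w → (∀ j → w (fr j) ≡ a * u0 (fr j) + b * u1 (fr j)) → w ∈⟨ ℓ ⟩
    front∈ℓ {w} a b hw h = (a ∷ b ∷ []) , λ t → trans (cong (a * u0 t +_) (+0 _)) (go t (split8 t))
      where
        go : ∀ t → Split8 t → a * u0 t + b * u1 t ≡ w t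
        go .(fr j) (isFr j) = sym (h j)
        go .(bk j) (isBk j) = trans (cong₂ (λ s t → a * s + b * t) (proj₁ hℓ j) (proj₂ hℓ j))
                                   (trans (*0+*0 a b) (sym (hw j)))

    u0≢Σ : ¬ InΣ u0
    u0≢Σ h = 1≢0 (proj₁ (frontEq 1# 0# 0# 0# (λ j → trans (1*+0* (u0 (fr j)) (u1 (fr j)))
                                                    (trans (h j) (sym (0*+0* (u0 (fr j)) (u1 (fr j))))))))

  module Phi (ℓ : Line 8) (liℓ : LinIndep ℓ) (hℓ : IsLine′ ℓ) (m : Line 8) (R : EchelonBasis m) where
    open LineOf ℓ liℓ hℓ public
    open EchelonBasis R public

    p′ : Fin 4
    p′ = punchIn p q
    ar : Fin 2 → Fin 4
    ar r = punchIn p (punchIn q r)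
    e : Fin 2 → Vect 8
    e r = δ (bk (ar r))

    g3 g4 : C4 → Vect 8
    g3 (A0 , A1 , B0 , B1) t = u0 t + (A0 * e zero t + A1 * e (suc zero) t)
    g4 (A0 , A1 , B0 , B1) t = u1 t + (B0 * e zero t + B1 * e (suc zero) t)

    Φ : C4 → Solid 8
    Φ α = n1 ∷ n2 ∷ g3 α ∷ g4 α ∷ []

    e-fr : ∀ r j → e r (fr j) ≡ 0#
    e-fr r j = δ-≢ (bk (ar r)) (fr j) (λ x → fr≢bk j (ar r) (sym x))
    ar≢p : ∀ r → ar r ≢ p
    ar≢p r = FinP.punchInᵢ≢i p (punchIn q r)
    ar≢p′ : ∀ r → ar r ≢ p′
    ar≢p′ r x = FinP.punchInᵢ≢i q r (FinP.punchIn-injective p _ _ x)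
    e-p : ∀ r → e r (bk p) ≡ 0#
    e-p r = δ-≢ (bk (ar r)) (bk p) (λ x → ar≢p r (bk-inj _ _ x))
    e-p′ : ∀ r → e r (bk p′) ≡ 0#
    e-p′ r = δ-≢ (bk (ar r)) (bk p′) (λ x → ar≢p′ r (bk-inj _ _ x))
    e-a : ∀ r r′ → e r (bk (ar r′)) ≡ δ r r′
    e-a r r′ = δ-inj (λ r → bk (ar r)) (λ a b x → FinP.punchIn-injective q _ _ (FinP.punchIn-injective p _ _ (bk-inj _ _ x))) r r′

    evalΦ : ∀ (α : C4) c0 c1 c2 c3 t → lincomb (c0 ∷ c1 ∷ c2 ∷ c3 ∷ []) (Φ α) t ≡
            c0 * n1 t + c1 * n2 t + c2 * u0 t + c3 * u1 t
            + (c2 * proj₁ α + c3 * proj₁ (proj₂ (proj₂ α))) * e zero t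
            + (c2 * proj₁ (proj₂ α) + c3 * proj₂ (proj₂ (proj₂ α))) * e (suc zero) t
    evalΦ (A0 , A1 , B0 , B1) c0 c1 c2 c3 t =
      solve 14 (λ c0 c1 c2 c3 n1 n2 u0 u1 A0 A1 B0 B1 e0 e1 →
        c0 :* n1 :+ (c1 :* n2 :+ (c2 :* (u0 :+ (A0 :* e0 :+ A1 :* e1)) :+ (c3 :* (u1 :+ (B0 :* e0 :+ B1 :* e1)) :+ :0)))
        := c0 :* n1 :+ c1 :* n2 :+ c2 :* u0 :+ c3 :* u1 :+ (c2 :* A0 :+ c3 :* B0) :* e0 :+ (c2 :* A1 :+ c3 :* B1) :* e1) refl
        c0 c1 c2 c3 (n1 t) (n2 t) (u0 t) (u1 t) A0 A1 B0 B1 (e zero t) (e (suc zero) t)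

    lc4 : ∀ {c : Fin 4 → Carrier} → c ≐ (c zero ∷ c (suc zero) ∷ c (suc (suc zero)) ∷ c (suc (suc (suc zero))) ∷ []) →
          ∀ α t → lincomb c (Φ α) t ≡ lincomb (c zero ∷ c (suc zero) ∷ c (suc (suc zero)) ∷ c (suc (suc (suc zero))) ∷ []) (Φ α) t
    lc4 {c} h α t = ∑-cong 4 (λ i → cong (_* Φ α i t) (h i))

    c≐ : ∀ (c : Fin 4 → Carrier) → c ≐ (c zero ∷ c (suc zero) ∷ c (suc (suc zero)) ∷ c (suc (suc (suc zero))) ∷ [])
    c≐ c zero = refl
    c≐ c (suc zero) = refl
    c≐ c (suc (suc zero)) = refl
    c≐ c (suc (suc (suc zero))) = refl

    module Ev (α : C4) (c : Fin 4 → Carrier) where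
      c0 = c zero
      c1 = c (suc zero)
      c2 = c (suc (suc zero))
      c3 = c (suc (suc (suc zero)))
      A0 = proj₁ α
      A1 = proj₁ (proj₂ α)
      B0 = proj₁ (proj₂ (proj₂ α))
      B1 = proj₂ (proj₂ (proj₂ α))
      ev : ∀ t → lincomb c (Φ α) t ≡ c0 * n1 t + c1 * n2 t + c2 * u0 t + c3 * u1 t + (c2 * A0 + c3 * B0) * e zero t + (c2 * A1 + c3 * B1) * e (suc zero) t
      ev t = trans (lc4 (c≐ c) α t) (evalΦ α c0 c1 c2 c3 t)
      ev-fr : ∀ j → lincomb c (Φ α) (fr j) ≡ c2 * u0 (fr j) + c3 * u1 (fr j)
      ev-fr j = trans (ev (fr j)) (trans (cong₂ (λ a b → c0 * a + c1 * b + c2 * u0 (fr j) + c3 * u1 (fr j) + (c2 * A0 + c3 * B0) * e zero (fr j) + (c2 * A1 + c3 * B1) * e (suc zero) (fr j)) (n1Σ j) (n2Σ j))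
                  (trans (cong₂ (λ a b → c0 * 0# + c1 * 0# + c2 * u0 (fr j) + c3 * u1 (fr j) + (c2 * A0 + c3 * B0) * a + (c2 * A1 + c3 * B1) * b) (e-fr zero j) (e-fr (suc zero) j))
                    (solve 8 (λ c0 c1 c2 c3 u v x y → c0 :* :0 :+ c1 :* :0 :+ c2 :* u :+ c3 :* v :+ x :* :0 :+ y :* :0 := c2 :* u :+ c3 :* v) refl
                        c0 c1 c2 c3 (u0 (fr j)) (u1 (fr j)) (c2 * A0 + c3 * B0) (c2 * A1 + c3 * B1))))
      ev-p : lincomb c (Φ α) (bk p) ≡ c0
      ev-p = trans (ev (bk p)) (trans (cong₂ (λ a b → c0 * a + c1 * b + c2 * u0 (bk p) + c3 * u1 (bk p) + (c2 * A0 + c3 * B0) * e zero (bk p) + (c2 * A1 + c3 * B1) * e (suc zero) (bk p)) n1p n2p)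
               (trans (cong₂ (λ a b → c0 * 1# + c1 * 0# + c2 * a + c3 * b + (c2 * A0 + c3 * B0) * e zero (bk p) + (c2 * A1 + c3 * B1) * e (suc zero) (bk p)) (proj₁ hℓ p) (proj₂ hℓ p))
                 (trans (cong₂ (λ a b → c0 * 1# + c1 * 0# + c2 * 0# + c3 * 0# + (c2 * A0 + c3 * B0) * a + (c2 * A1 + c3 * B1) * b) (e-p zero) (e-p (suc zero)))
                   (solve 6 (λ c0 c1 c2 c3 x y → c0 :* :1 :+ c1 :* :0 :+ c2 :* :0 :+ c3 :* :0 :+ x :* :0 :+ y :* :0 := c0) refl
                      c0 c1 c2 c3 (c2 * A0 + c3 * B0) (c2 * A1 + c3 * B1)))))
      ev-p′ : lincomb c (Φ α) (bk p′) ≡ c1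
      ev-p′ = trans (ev (bk p′)) (trans (cong₂ (λ a b → c0 * a + c1 * b + c2 * u0 (bk p′) + c3 * u1 (bk p′) + (c2 * A0 + c3 * B0) * e zero (bk p′) + (c2 * A1 + c3 * B1) * e (suc zero) (bk p′)) n1p′ n2p′)
               (trans (cong₂ (λ a b → c0 * 0# + c1 * 1# + c2 * a + c3 * b + (c2 * A0 + c3 * B0) * e zero (bk p′) + (c2 * A1 + c3 * B1) * e (suc zero) (bk p′)) (proj₁ hℓ p′) (proj₂ hℓ p′))
                 (trans (cong₂ (λ a b → c0 * 0# + c1 * 1# + c2 * 0# + c3 * 0# + (c2 * A0 + c3 * B0) * a + (c2 * A1 + c3 * B1) * b) (e-p′ zero) (e-p′ (suc zero)))
                   (solve 6 (λ c0 c1 c2 c3 x y → c0 :* :0 :+ c1 :* :1 :+ c2 :* :0 :+ c3 :* :0 :+ x :* :0 :+ y :* :0 := c1) refl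
                      c0 c1 c2 c3 (c2 * A0 + c3 * B0) (c2 * A1 + c3 * B1)))))
      ev-a0 : lincomb c (Φ α) (bk (ar zero)) ≡ c0 * n1 (bk (ar zero)) + c1 * n2 (bk (ar zero)) + (c2 * A0 + c3 * B0)
      ev-a0 = trans (ev t) (trans (cong₂ (λ a b → c0 * n1 t + c1 * n2 t + c2 * a + c3 * b + (c2 * A0 + c3 * B0) * e zero t + (c2 * A1 + c3 * B1) * e (suc zero) t) (proj₁ hℓ (ar zero)) (proj₂ hℓ (ar zero)))
                 (trans (cong₂ (λ a b → c0 * n1 t + c1 * n2 t + c2 * 0# + c3 * 0# + (c2 * A0 + c3 * B0) * a + (c2 * A1 + c3 * B1) * b) (trans (e-a zero zero) (δ-refl {2} zero)) (trans (e-a (suc zero) zero) (δ-≢ {2} (suc zero) zero (λ ()))))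
                   (solve 6 (λ c2 c3 n m x y → n :+ m :+ c2 :* :0 :+ c3 :* :0 :+ x :* :1 :+ y :* :0 := n :+ m :+ x) refl
                      c2 c3 (c0 * n1 t) (c1 * n2 t) (c2 * A0 + c3 * B0) (c2 * A1 + c3 * B1))))
        where t = bk (ar zero)
      ev-a1 : lincomb c (Φ α) (bk (ar (suc zero))) ≡ c0 * n1 (bk (ar (suc zero))) + c1 * n2 (bk (ar (suc zero))) + (c2 * A1 + c3 * B1)
      ev-a1 = trans (ev t) (trans (cong₂ (λ a b → c0 * n1 t + c1 * n2 t + c2 * a + c3 * b + (c2 * A0 + c3 * B0) * e zero t + (c2 * A1 + c3 * B1) * e (suc zero) t) (proj₁ hℓ (ar (suc zero))) (proj₂ hℓ (ar (suc zero))))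
                 (trans (cong₂ (λ a b → c0 * n1 t + c1 * n2 t + c2 * 0# + c3 * 0# + (c2 * A0 + c3 * B0) * a + (c2 * A1 + c3 * B1) * b) (trans (e-a zero (suc zero)) (δ-≢ {2} zero (suc zero) (λ ()))) (trans (e-a (suc zero) (suc zero)) (δ-refl {2} (suc zero))))
                   (solve 6 (λ c2 c3 n m x y → n :+ m :+ c2 :* :0 :+ c3 :* :0 :+ x :* :0 :+ y :* :1 := n :+ m :+ y) refl
                      c2 c3 (c0 * n1 t) (c1 * n2 t) (c2 * A0 + c3 * B0) (c2 * A1 + c3 * B1))))
        where t = bk (ar (suc zero))



    g3-fr : ∀ α j → g3 α (fr j) ≡ u0 (fr j)
    g3-fr (A0 , A1 , B0 , B1) j = trans (cong₂ (λ a b → u0 (fr j) + (A0 * a + A1 * b)) (e-fr zero j) (e-fr (suc zero) j))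
                                     (solve 3 (λ u a b → u :+ (a :* :0 :+ b :* :0) := u) refl (u0 (fr j)) A0 A1)
    g4-fr : ∀ α j → g4 α (fr j) ≡ u1 (fr j)
    g4-fr (A0 , A1 , B0 , B1) j = trans (cong₂ (λ a b → u1 (fr j) + (B0 * a + B1 * b)) (e-fr zero j) (e-fr (suc zero) j))
                                     (solve 3 (λ u a b → u :+ (a :* :0 :+ b :* :0) := u) refl (u1 (fr j)) B0 B1)

    gv-p : ∀ (u : Vect 8) (a b : Carrier) (hu : InΣ′ u) → u (bk p) + (a * e zero (bk p) + b * e (suc zero) (bk p)) ≡ 0#
    gv-p u a b hu = trans (cong₂ (λ x y → u (bk p) + (a * x + b * y)) (e-p zero) (e-p (suc zero)))
                      (trans (cong (_+ (a * 0# + b * 0#)) (hu p)) (solve 2 (λ a b → :0 :+ (a :* :0 :+ b :* :0) := :0) refl a b))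
    gv-p′ : ∀ (u : Vect 8) (a b : Carrier) (hu : InΣ′ u) → u (bk p′) + (a * e zero (bk p′) + b * e (suc zero) (bk p′)) ≡ 0#
    gv-p′ u a b hu = trans (cong₂ (λ x y → u (bk p′) + (a * x + b * y)) (e-p′ zero) (e-p′ (suc zero)))
                      (trans (cong (_+ (a * 0# + b * 0#)) (hu p′)) (solve 2 (λ a b → :0 :+ (a :* :0 :+ b :* :0) := :0) refl a b))
    gv-a0 : ∀ u a b (hu : InΣ′ u) → u (bk (ar zero)) + (a * e zero (bk (ar zero)) + b * e (suc zero) (bk (ar zero))) ≡ a
    gv-a0 u a b hu = trans (cong₂ (λ x y → u (bk (ar zero)) + (a * x + b * y)) (trans (e-a zero zero) (δ-refl {2} zero)) (trans (e-a (suc zero) zero) (δ-≢ {2} (suc zero) zero (λ ()))))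
                      (trans (cong (_+ (a * 1# + b * 0#)) (hu (ar zero))) (solve 2 (λ a b → :0 :+ (a :* :1 :+ b :* :0) := a) refl a b))
    gv-a1 : ∀ u a b (hu : InΣ′ u) → u (bk (ar (suc zero))) + (a * e zero (bk (ar (suc zero))) + b * e (suc zero) (bk (ar (suc zero)))) ≡ b
    gv-a1 u a b hu = trans (cong₂ (λ x y → u (bk (ar (suc zero))) + (a * x + b * y)) (trans (e-a zero (suc zero)) (δ-≢ {2} zero (suc zero) (λ ()))) (trans (e-a (suc zero) (suc zero)) (δ-refl {2} (suc zero))))
                      (trans (cong (_+ (a * 0# + b * 1#)) (hu (ar (suc zero)))) (solve 2 (λ a b → :0 :+ (a :* :0 :+ b :* :1) := b) refl a b))

    Φ⊆Γ : ∀ α → Φ α ⊆ Γ ℓ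
    Φ⊆Γ α = ⊆-gens {S = Γ ℓ} {T = Φ α} λ
      { zero → Σ⊆Γ ℓ hℓ (Σ-char← n1Σ)
      ; (suc zero) → Σ⊆Γ ℓ hℓ (Σ-char← n2Σ)
      ; (suc (suc zero)) → Γ-intro ℓ hℓ 1# 0# (λ j → trans (g3-fr α j) (sym (1*+0* (u0 (fr j)) (u1 (fr j)))))
      ; (suc (suc (suc zero))) → Γ-intro ℓ hℓ 0# 1# (λ j → trans (g4-fr α j) (sym (0*+1* (u0 (fr j)) (u1 (fr j))))) }

    frontZero : ∀ α c → (∀ j → lincomb c (Φ α) (fr j) ≡ 0#) → c (suc (suc zero)) ≡ 0# × c (suc (suc (suc zero))) ≡ 0#
    frontZero α c h = frontEq _ _ 0# 0# (λ j → trans (sym (Ev.ev-fr α c j)) (trans (h j)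
                         (sym (0*+0* (u0 (fr j)) (u1 (fr j))))))

    Φ-indep : ∀ α → LinIndep (Φ α)
    Φ-indep α c h = λ { zero → trans (sym (Ev.ev-p α c)) (h (bk p))
                      ; (suc zero) → trans (sym (Ev.ev-p′ α c)) (h (bk p′))
                      ; (suc (suc zero)) → proj₁ fz
                      ; (suc (suc (suc zero))) → proj₂ fz }
      where fz = frontZero α c (λ j → h (fr j))

    g3∈ : ∀ α → g3 α ∈⟨ Φ α ⟩
    g3∈ α = ∈-gen (Φ α) (suc (suc zero))
    g4∈ : ∀ α → g4 α ∈⟨ Φ α ⟩
    g4∈ α = ∈-gen (Φ α) (suc (suc (suc zero)))

    Φ-notΣ : ∀ α → ¬ (Φ α ≈ Σs)
    Φ-notΣ α (Φ⊆Σ , _) = u0≢Σ (λ j → trans (sym (g3-fr α j)) (Σ-char→ (Φ⊆Σ (g3 α) (g3∈ α)) j))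

    nl⊆Φ : ∀ α → mkLine n1 n2 ⊆ Φ α
    nl⊆Φ α = ⊆-gens {S = Φ α} {T = mkLine n1 n2} (λ { zero → ∈-gen (Φ α) zero ; (suc zero) → ∈-gen (Φ α) (suc zero) })

    m⊆Φ : ∀ α → m ⊆ Φ α
    m⊆Φ α = ⊆-trans {A = m} {B = mkLine n1 n2} {C = Φ α} m⊆n (nl⊆Φ α)

    nlΣ : ∀ {v} → v ∈⟨ mkLine n1 n2 ⟩ → InΣ v
    nlΣ {v} (c , h) j = trans (sym (h (fr j))) (trans (cong₂ (λ a b → c zero * a + (c (suc zero) * b + 0#)) (n1Σ j) (n2Σ j))
                          (solve 2 (λ a b → a :* :0 :+ (b :* :0 :+ :0) := :0) refl (c zero) (c (suc zero))))

    mΣ : ∀ {v} → v ∈⟨ m ⟩ → InΣ v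
    mΣ {v} vm = nlΣ (m⊆n v vm)

    Φ∩Σ : ∀ α {v} → v ∈⟨ Φ α ⟩ → InΣ v → v ∈⟨ m ⟩
    Φ∩Σ α {v} (c , h) hv = n⊆m v ((c zero ∷ c (suc zero) ∷ []) , λ t → trans (eq t) (h t))
      where
        fz = frontZero α c (λ j → trans (h (fr j)) (hv j))
        open Ev α c
        eq : ∀ t → lincomb (c zero ∷ c (suc zero) ∷ []) (mkLine n1 n2) t ≡ lincomb c (Φ α) t
        eq t = sym (trans (ev t) (trans (cong₂ (λ x y → c0 * n1 t + c1 * n2 t + x * u0 t + y * u1 t + (x * A0 + y * B0) * e zero t + (x * A1 + y * B1) * e (suc zero) t) (proj₁ fz) (proj₂ fz))
                 (solve 12 (λ c0 c1 n m u v a b a′ b′ e f → c0 :* n :+ c1 :* m :+ :0 :* u :+ :0 :* v :+ (:0 :* a :+ :0 :* b) :* e :+ (:0 :* a′ :+ :0 :* b′) :* f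
                        := c0 :* n :+ (c1 :* m :+ :0)) refl c0 c1 (n1 t) (n2 t) (u0 t) (u1 t) A0 B0 A1 B1 (e zero t) (e (suc zero) t))))

    memb : ∀ α′ (v : Vect 8) a b → v ∈⟨ Φ α′ ⟩ → (∀ j → v (fr j) ≡ a * u0 (fr j) + b * u1 (fr j)) →
           v (bk p) ≡ 0# → v (bk p′) ≡ 0# →
           (v (bk (ar zero)) ≡ a * proj₁ α′ + b * proj₁ (proj₂ (proj₂ α′)))
           × (v (bk (ar (suc zero))) ≡ a * proj₁ (proj₂ α′) + b * proj₂ (proj₂ (proj₂ α′)))
    memb α′ v a b (c , h) hf hp hp′ = e0 , e1
      where
        open Ev α′ c
        fe = frontEq c2 c3 a b (λ j → trans (sym (ev-fr j)) (trans (h (fr j)) (hf j)))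
        c0z : c0 ≡ 0#
        c0z = trans (sym ev-p) (trans (h (bk p)) hp)
        c1z : c1 ≡ 0#
        c1z = trans (sym ev-p′) (trans (h (bk p′)) hp′)
        e0 : v (bk (ar zero)) ≡ a * A0 + b * B0
        e0 = trans (sym (h _)) (trans ev-a0 (trans (cong₂ (λ x y → x * n1 (bk (ar zero)) + y * n2 (bk (ar zero)) + (c2 * A0 + c3 * B0)) c0z c1z)
               (trans (cong₂ (λ x y → 0# * n1 (bk (ar zero)) + 0# * n2 (bk (ar zero)) + (x * A0 + y * B0)) (proj₁ fe) (proj₂ fe))
                 (solve 6 (λ n m a b x y → :0 :* n :+ :0 :* m :+ (a :* x :+ b :* y) := a :* x :+ b :* y) refl (n1 (bk (ar zero))) (n2 (bk (ar zero))) a b A0 B0))))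
        e1 : v (bk (ar (suc zero))) ≡ a * A1 + b * B1
        e1 = trans (sym (h _)) (trans ev-a1 (trans (cong₂ (λ x y → x * n1 (bk (ar (suc zero))) + y * n2 (bk (ar (suc zero))) + (c2 * A1 + c3 * B1)) c0z c1z)
               (trans (cong₂ (λ x y → 0# * n1 (bk (ar (suc zero))) + 0# * n2 (bk (ar (suc zero))) + (x * A1 + y * B1)) (proj₁ fe) (proj₂ fe))
                 (solve 6 (λ n m a b x y → :0 :* n :+ :0 :* m :+ (a :* x :+ b :* y) := a :* x :+ b :* y) refl (n1 (bk (ar (suc zero)))) (n2 (bk (ar (suc zero)))) a b A1 B1))))

    -- hence Φ α ⊆ Φ α′ forces α = α′ (compare the last two generators of Φ α)
    Φ-inj : ∀ α α′ → Φ α ⊆ Φ α′ → α ≡ α′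
    Φ-inj (A0 , A1 , B0 , B1) (A0′ , A1′ , B0′ , B1′) sub =
      cong₄ ((trans (sym (gv-a0 u0 A0 A1 (proj₁ hℓ))) (trans (proj₁ m3) (l10 A0′ B0′))))
            ((trans (sym (gv-a1 u0 A0 A1 (proj₁ hℓ))) (trans (proj₂ m3) (l10 A1′ B1′))))
            ((trans (sym (gv-a0 u1 B0 B1 (proj₂ hℓ))) (trans (proj₁ m4) (l01 A0′ B0′))))
            ((trans (sym (gv-a1 u1 B0 B1 (proj₂ hℓ))) (trans (proj₂ m4) (l01 A1′ B1′))))
      where
        α = (A0 , A1 , B0 , B1)
        α′ = (A0′ , A1′ , B0′ , B1′)
        cong₄ : ∀ {a b c d a′ b′ c′ d′ : Carrier} → a ≡ a′ → b ≡ b′ → c ≡ c′ → d ≡ d′ → (a , b , c , d) ≡ (a′ , b′ , c′ , d′)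
        cong₄ refl refl refl refl = refl
        l10 : ∀ x y → 1# * x + 0# * y ≡ x
        l10 = 1*+0*
        l01 : ∀ x y → 0# * x + 1# * y ≡ y
        l01 = 0*+1*
        m3 = memb α′ (g3 α) 1# 0# (sub (g3 α) (g3∈ α))
               (λ j → trans (g3-fr α j) (sym (1*+0* (u0 (fr j)) (u1 (fr j)))))
               (gv-p u0 A0 A1 (proj₁ hℓ)) (gv-p′ u0 A0 A1 (proj₁ hℓ))
        m4 = memb α′ (g4 α) 0# 1# (sub (g4 α) (g4∈ α))
               (λ j → trans (g4-fr α j) (sym (0*+1* (u0 (fr j)) (u1 (fr j)))))
               (gv-p u1 B0 B1 (proj₂ hℓ)) (gv-p′ u1 B0 B1 (proj₂ hℓ))

    -- A solid S ⊆ Γ_ℓ with S ∩ Σ = m and a front basis s, t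
    -- equals Φ α, where α reads off the non-pivot back coordinates of s, t
    -- after clearing their pivot entries with n₁, n₂.
    module Complete (S : Solid 8) (liS : LinIndep S) (S⊆ : S ⊆ Γ ℓ)
                    (SΣ : ∀ v → v ∈⟨ S ⟩ → InΣ v → v ∈⟨ m ⟩) (mS : m ⊆ S) (sp : FrontBasis ℓ S) where
      open FrontBasis sp

      n1∈S : n1 ∈⟨ S ⟩
      n1∈S = mS n1 (n⊆m n1 (∈-gen (mkLine n1 n2) zero))
      n2∈S : n2 ∈⟨ S ⟩
      n2∈S = mS n2 (n⊆m n2 (∈-gen (mkLine n1 n2) (suc zero)))

      red : Vect 8 → Vect 8
      red w = lincomb (1# ∷ (- w (bk p)) ∷ (- w (bk p′)) ∷ []) (w ∷ n1 ∷ n2 ∷ [])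

      red∈ : ∀ w → w ∈⟨ S ⟩ → red w ∈⟨ S ⟩
      red∈ w w∈ = ∈-comb S (w ∷ n1 ∷ n2 ∷ []) (1# ∷ (- w (bk p)) ∷ (- w (bk p′)) ∷ [])
                    (λ { zero → w∈ ; (suc zero) → n1∈S ; (suc (suc zero)) → n2∈S }) (λ _ → refl)

      red-fr : ∀ w j → red w (fr j) ≡ w (fr j)
      red-fr w j = trans (cong₂ (λ x y → 1# * w (fr j) + (- w (bk p) * x + (- w (bk p′) * y + 0#))) (n1Σ j) (n2Σ j))
                     (solve 3 (λ a b c → :1 :* a :+ (b :* :0 :+ (c :* :0 :+ :0)) := a) refl (w (fr j)) (- w (bk p)) (- w (bk p′)))
      red-p : ∀ w → red w (bk p) ≡ 0#
      red-p w = trans (cong₂ (λ x y → 1# * w (bk p) + (- w (bk p) * x + (- w (bk p′) * y + 0#))) n1p n2p)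
                  (solve 2 (λ a b → :1 :* a :+ (:- a :* :1 :+ (:- b :* :0 :+ :0)) := :0) refl (w (bk p)) (w (bk p′)))
      red-p′ : ∀ w → red w (bk p′) ≡ 0#
      red-p′ w = trans (cong₂ (λ x y → 1# * w (bk p′) + (- w (bk p) * x + (- w (bk p′) * y + 0#))) n1p′ n2p′)
                  (solve 2 (λ a b → :1 :* b :+ (:- a :* :0 :+ (:- b :* :1 :+ :0)) := :0) refl (w (bk p)) (w (bk p′)))

      s′ t′ : Vect 8
      s′ = red s
      t′ = red t
      α : C4
      α = (s′ (bk (ar zero)) , s′ (bk (ar (suc zero))) , t′ (bk (ar zero)) , t′ (bk (ar (suc zero))))

      g3≐ : ∀ x → g3 α x ≡ s′ x
      g3≐ x with split8 x
      ... | isFr j = trans (g3-fr α j) (sym (trans (red-fr s j) (trans (sF j) (1*+0* (u0 (fr j)) (u1 (fr j))))))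
      ... | isBk j with cover p q j
      ...   | cP = trans (gv-p u0 _ _ (proj₁ hℓ)) (sym (red-p s))
      ...   | cP′ = trans (gv-p′ u0 _ _ (proj₁ hℓ)) (sym (red-p′ s))
      ...   | cA zero = gv-a0 u0 _ _ (proj₁ hℓ)
      ...   | cA (suc zero) = gv-a1 u0 _ _ (proj₁ hℓ)
      g4≐ : ∀ x → g4 α x ≡ t′ x
      g4≐ x with split8 x
      ... | isFr j = trans (g4-fr α j) (sym (trans (red-fr t j) (trans (tF j) (0*+1* (u0 (fr j)) (u1 (fr j))))))
      ... | isBk j with cover p q j
      ...   | cP = trans (gv-p u1 _ _ (proj₂ hℓ)) (sym (red-p t))
      ...   | cP′ = trans (gv-p′ u1 _ _ (proj₂ hℓ)) (sym (red-p′ t))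
      ...   | cA zero = gv-a0 u1 _ _ (proj₂ hℓ)
      ...   | cA (suc zero) = gv-a1 u1 _ _ (proj₂ hℓ)

      Φ⊆S : Φ α ⊆ S
      Φ⊆S = ⊆-gens {S = S} {T = Φ α} λ
        { zero → n1∈S ; (suc zero) → n2∈S
        ; (suc (suc zero)) → ∈-resp {g = S} (λ x → sym (g3≐ x)) (red∈ s s∈)
        ; (suc (suc (suc zero))) → ∈-resp {g = S} (λ x → sym (g4≐ x)) (red∈ t t∈) }

      S⊆Φ : S ⊆ Φ α
      S⊆Φ v v∈ = ∈-comb (Φ α) (w ∷ g3 α ∷ g4 α ∷ []) (1# ∷ a ∷ b ∷ [])
                   (λ { zero → m⊆Φ α w (SΣ w w∈S wΣ) ; (suc zero) → g3∈ α ; (suc (suc zero)) → g4∈ α })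
                   (λ x → solve 5 (λ v g h a b → v := :1 :* (:1 :* v :+ (:- a :* g :+ (:- b :* h :+ :0))) :+ (a :* g :+ (b :* h :+ :0))) refl
                            (v x) (g3 α x) (g4 α x) a b)
        where
          fv = Γ-front ℓ (S⊆ v v∈)
          a = proj₁ fv
          b = proj₁ (proj₂ fv)
          w = lincomb (1# ∷ (- a) ∷ (- b) ∷ []) (v ∷ g3 α ∷ g4 α ∷ [])
          w∈S : w ∈⟨ S ⟩
          w∈S = ∈-comb S (v ∷ g3 α ∷ g4 α ∷ []) (1# ∷ (- a) ∷ (- b) ∷ [])
                  (λ { zero → v∈ ; (suc zero) → Φ⊆S (g3 α) (g3∈ α) ; (suc (suc zero)) → Φ⊆S (g4 α) (g4∈ α) }) (λ _ → refl)
          wΣ : InΣ w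
          wΣ j = trans (cong₃ (proj₂ (proj₂ fv) j) (g3-fr α j) (g4-fr α j))
                   (solve 5 (λ a b u v z → :1 :* (a :* u :+ b :* v) :+ (:- a :* u :+ (:- b :* v :+ :0)) := :0) refl a b (u0 (fr j)) (u1 (fr j)) a)
            where cong₃ : ∀ {x x′ y y′ z z′} → x ≡ x′ → y ≡ y′ → z ≡ z′ → 1# * x + (- a * y + (- b * z + 0#)) ≡ 1# * x′ + (- a * y′ + (- b * z′ + 0#))
                  cong₃ refl refl refl = refl

      result : Σ C4 λ α → S ≈ Φ α
      result = α , S⊆Φ , Φ⊆S



  -- A line is the
  -- kernel of a nonzero linear form, which we normalise so that its first
  -- nonzero coefficient is 1: (1, a, b), (0, 1, c) or (0, 0, 1).  PlaneLine
  -- indexes these q² + q + 1 normal forms; linePt₀ k and linePt₁ k span the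
  -- kernel of lineForm k.

  C3 : Set
  C3 = Carrier × Carrier × Carrier

  PlaneLine : Set
  PlaneLine = (Carrier × Carrier ⊎ Carrier) ⊎ ⊤

  lineForm linePt₀ linePt₁ : PlaneLine → C3
  lineForm (inj₁ (inj₁ (a , b))) = 1# , a , b
  lineForm (inj₁ (inj₂ c)) = 0# , 1# , c
  lineForm (inj₂ tt) = 0# , 0# , 1#
  linePt₀ (inj₁ (inj₁ (a , b))) = - a , 1# , 0#
  linePt₀ (inj₁ (inj₂ c)) = 1# , 0# , 0#
  linePt₀ (inj₂ tt) = 1# , 0# , 0#
  linePt₁ (inj₁ (inj₁ (a , b))) = - b , 0# , 1#
  linePt₁ (inj₁ (inj₂ c)) = 0# , - c , 1#
  linePt₁ (inj₂ tt) = 0# , 1# , 0#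

  dot3 : C3 → C3 → Carrier
  dot3 (a , b , c) (x , y , z) = a * x + b * y + c * z

  comb3 : Carrier → Carrier → C3 → C3 → C3
  comb3 c0 c1 (a , b , c) (x , y , z) = c0 * a + c1 * x , c0 * b + c1 * y , c0 * c + c1 * z

  dot3-comb : ∀ f c0 c1 x y → dot3 f (comb3 c0 c1 x y) ≡ c0 * dot3 f x + c1 * dot3 f y
  dot3-comb (f0 , f1 , f2) c0 c1 (a , b , c) (x , y , z) =
    solve 11 (λ f0 f1 f2 c0 c1 a b c x y z → f0 :* (c0 :* a :+ c1 :* x) :+ f1 :* (c0 :* b :+ c1 :* y) :+ f2 :* (c0 :* c :+ c1 :* z)
                 := c0 :* (f0 :* a :+ f1 :* b :+ f2 :* c) :+ c1 :* (f0 :* x :+ f1 :* y :+ f2 :* z)) refl f0 f1 f2 c0 c1 a b c x y z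

  fx0 : ∀ k → dot3 (lineForm k) (linePt₀ k) ≡ 0#
  fx0 (inj₁ (inj₁ (a , b))) = solve 2 (λ a b → :1 :* (:- a) :+ a :* :1 :+ b :* :0 := :0) refl a b
  fx0 (inj₁ (inj₂ c)) = solve 1 (λ c → :0 :* :1 :+ :1 :* :0 :+ c :* :0 := :0) refl c
  fx0 (inj₂ tt) = solve 0 (:0 :* :1 :+ :0 :* :0 :+ :1 :* :0 := :0) refl
  fy0 : ∀ k → dot3 (lineForm k) (linePt₁ k) ≡ 0#
  fy0 (inj₁ (inj₁ (a , b))) = solve 2 (λ a b → :1 :* (:- b) :+ a :* :0 :+ b :* :1 := :0) refl a b
  fy0 (inj₁ (inj₂ c)) = solve 1 (λ c → :0 :* :0 :+ :1 :* (:- c) :+ c :* :1 := :0) refl c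
  fy0 (inj₂ tt) = solve 0 (:0 :* :0 :+ :0 :* :1 :+ :1 :* :0 := :0) refl

  lineForm-unique : ∀ k k′ → dot3 (lineForm k′) (linePt₀ k) ≡ 0# → dot3 (lineForm k′) (linePt₁ k) ≡ 0# → k ≡ k′
  lineForm-unique (inj₁ (inj₁ (a , b))) (inj₁ (inj₁ (a′ , b′))) ex ey =
    cong (λ z → inj₁ (inj₁ z)) (cong₂ _,_ (sym (minus0 a′ a (trans (solve 3 (λ a a′ b′ → a′ :- a := :1 :* (:- a) :+ a′ :* :1 :+ b′ :* :0) refl a a′ b′) ex)))
                                          (sym (minus0 b′ b (trans (solve 3 (λ b a′ b′ → b′ :- b := :1 :* (:- b) :+ a′ :* :0 :+ b′ :* :1) refl b a′ b′) ey))))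
  lineForm-unique (inj₁ (inj₁ (a , b))) (inj₁ (inj₂ c′)) ex ey = ⊥-elim (1≢0 (trans (solve 2 (λ a c → :1 := :0 :* (:- a) :+ :1 :* :1 :+ c :* :0) refl a c′) ex))
  lineForm-unique (inj₁ (inj₁ (a , b))) (inj₂ tt) ex ey = ⊥-elim (1≢0 (trans (solve 1 (λ b → :1 := :0 :* (:- b) :+ :0 :* :0 :+ :1 :* :1) refl b) ey))
  lineForm-unique (inj₁ (inj₂ c)) (inj₁ (inj₁ (a′ , b′))) ex ey = ⊥-elim (1≢0 (trans (solve 2 (λ a b → :1 := :1 :* :1 :+ a :* :0 :+ b :* :0) refl a′ b′) ex))
  lineForm-unique (inj₁ (inj₂ c)) (inj₁ (inj₂ c′)) ex ey =
    cong (λ z → inj₁ (inj₂ z)) (sym (minus0 c′ c (trans (solve 2 (λ c c′ → c′ :- c := :0 :* :0 :+ :1 :* (:- c) :+ c′ :* :1) refl c c′) ey)))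
  lineForm-unique (inj₁ (inj₂ c)) (inj₂ tt) ex ey = ⊥-elim (1≢0 (trans (solve 1 (λ c → :1 := :0 :* :0 :+ :0 :* (:- c) :+ :1 :* :1) refl c) ey))
  lineForm-unique (inj₂ tt) (inj₁ (inj₁ (a′ , b′))) ex ey = ⊥-elim (1≢0 (trans (solve 2 (λ a b → :1 := :1 :* :1 :+ a :* :0 :+ b :* :0) refl a′ b′) ex))
  lineForm-unique (inj₂ tt) (inj₁ (inj₂ c′)) ex ey = ⊥-elim (1≢0 (trans (solve 1 (λ c → :1 := :0 :* :0 :+ :1 :* :1 :+ c :* :0) refl c′) ey))
  lineForm-unique (inj₂ tt) (inj₂ tt) ex ey = refl

  normaliseForm : ∀ (f : C3) → ¬ (proj₁ f ≡ 0# × proj₁ (proj₂ f) ≡ 0# × proj₂ (proj₂ f) ≡ 0#) →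
          Σ PlaneLine λ k → ∀ u → dot3 f u ≡ 0# → dot3 (lineForm k) u ≡ 0#
  normaliseForm (f0 , f1 , f2) nz with f0 ≟ 0#
  ... | no n0 = inj₁ (inj₁ (κ * f1 , κ * f2)) , λ { (x , y , z) e → trans (lem x y z) (trans (cong (κ *_) e) (*0 κ)) }
    where κ = inv f0 n0
          lem : ∀ x y z → 1# * x + κ * f1 * y + κ * f2 * z ≡ κ * (f0 * x + f1 * y + f2 * z)
          lem x y z = trans (cong (λ s → s * x + κ * f1 * y + κ * f2 * z) (sym (inv-l f0 n0)))
                            (solve 7 (λ κ f0 f1 f2 x y z → κ :* f0 :* x :+ κ :* f1 :* y :+ κ :* f2 :* z := κ :* (f0 :* x :+ f1 :* y :+ f2 :* z)) refl κ f0 f1 f2 x y z)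
  ... | yes e0 with f1 ≟ 0#
  ...   | no n1 = inj₁ (inj₂ (κ * f2)) , λ { (x , y , z) e → trans (lem x y z) (trans (cong (κ *_) e) (*0 κ)) }
    where κ = inv f1 n1
          lem : ∀ x y z → 0# * x + 1# * y + κ * f2 * z ≡ κ * (f0 * x + f1 * y + f2 * z)
          lem x y z = trans (cong (λ s → 0# * x + s * y + κ * f2 * z) (sym (inv-l f1 n1)))
                       (trans (solve 6 (λ κ f1 f2 x y z → :0 :* x :+ κ :* f1 :* y :+ κ :* f2 :* z := κ :* (:0 :* x :+ f1 :* y :+ f2 :* z)) refl κ f1 f2 x y z)
                              (cong (λ s → κ * (s * x + f1 * y + f2 * z)) (sym e0)))
  ...   | yes e1 with f2 ≟ 0#
  ...     | yes e2 = ⊥-elim (nz (e0 , e1 , e2))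
  ...     | no n2 = inj₂ tt , λ { (x , y , z) e → trans (lem x y z) (trans (cong (κ *_) e) (*0 κ)) }
    where κ = inv f2 n2
          lem : ∀ x y z → 0# * x + 0# * y + 1# * z ≡ κ * (f0 * x + f1 * y + f2 * z)
          lem x y z = trans (cong (λ s → 0# * x + 0# * y + s * z) (sym (inv-l f2 n2)))
                       (trans (solve 5 (λ κ f2 x y z → :0 :* x :+ :0 :* y :+ κ :* f2 :* z := κ :* (:0 :* x :+ :0 :* y :+ f2 :* z)) refl κ f2 x y z)
                              (cong₂ (λ s t → κ * (s * x + t * y + f2 * z)) (sym e0) (sym e1)))

  module Config (q : ℕ) (A : Fin (q N.^ 12) → Mat) (P P′ : Parallelism q 8) (parP : IsParallelism q Σs P) (parP′ : IsParallelism q Σ′ P′)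
             (μ : Permutation′ (suc (q N.* q N.+ q))) where
    open Family q A P P′ μ public

    mline : ParIx q → SpreadIx q → Line 8
    mline j i = P (μ ⟨$⟩ʳ j) i
    mLineOf : ∀ j i → IsLineOf (mline j i) Σs
    mLineOf j i = proj₁ (proj₁ parP (μ ⟨$⟩ʳ j)) i
    mΣ0 : ∀ j i → InΣ (mline j i zero)
    mΣ0 j i = Σ-char→ (proj₂ (mLineOf j i) _ (∈-gen (mline j i) zero))
    mΣ1 : ∀ j i → InΣ (mline j i (suc zero))
    mΣ1 j i = Σ-char→ (proj₂ (mLineOf j i) _ (∈-gen (mline j i) (suc zero)))
    mR : ∀ j i → EchelonBasis (mline j i)
    mR j i = echelonBasis (mline j i) (proj₁ (mLineOf j i)) (mΣ0 j i) (mΣ1 j i)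
    disj : ∀ j i i′ → i ≢ i′ → ∀ v → v ∈⟨ mline j i ⟩ → v ∈⟨ mline j i′ ⟩ → IsZero v
    disj j i i′ = proj₂ (proj₂ (proj₁ parP (μ ⟨$⟩ʳ j))) i i′

    hOf : ∀ {ℓ} → IsLineOf ℓ Σ′ → IsLine′ ℓ
    hOf {ℓ} isl = Σ′-char→ (proj₂ isl _ (∈-gen ℓ zero)) , Σ′-char→ (proj₂ isl _ (∈-gen ℓ (suc zero)))

    -- If a member S of Z, built on the line ℓ′ of Σ′, lies in Γ_ℓ for a line
    -- ℓ of Σ′, then ℓ′ ⊆ ℓ: a front basis of S shows that the fronts of ℓ′
    -- are fronts of vectors of Γ_ℓ, and Σ′-vectors with such fronts lie in ℓ.
    zLine⊆ : (ℓ : Line 8) → IsLineOf ℓ Σ′ → ∀ S → (z : InZ S) → S ⊆ Γ ℓ → proj₁ z ⊆ ℓ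
    zLine⊆ ℓ isl S (ℓ′ , j , isl′ , inSp , liS , S⊆′ , notΣ , i , iff) S⊆ = ⊆-gens {S = ℓ} {T = ℓ′} λ
        { zero → let fs = Γ-front ℓ (S⊆ s s∈) in
                 LineOf.front∈ℓ ℓ (proj₁ isl) (hOf {ℓ} isl) (proj₁ fs) (proj₁ (proj₂ fs)) (proj₁ hℓ′)
                   (λ j → trans (sym (trans (sF j) (1*+0* (ℓ′ zero (fr j)) (ℓ′ (suc zero) (fr j))))) (proj₂ (proj₂ fs) j))
        ; (suc zero) → let ft = Γ-front ℓ (S⊆ t t∈) in
                 LineOf.front∈ℓ ℓ (proj₁ isl) (hOf {ℓ} isl) (proj₁ ft) (proj₁ (proj₂ ft)) (proj₂ hℓ′)
                   (λ j → trans (sym (trans (tF j) (0*+1* (ℓ′ zero (fr j)) (ℓ′ (suc zero) (fr j))))) (proj₂ (proj₂ ft) j)) }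
      where
        hℓ′ : IsLine′ ℓ′
        hℓ′ = hOf {ℓ′} isl′
        open FrontBasis (frontBasis ℓ′ S (P (μ ⟨$⟩ʳ j) i) liS S⊆′ (λ v a b → proj₁ (iff v) (a , Σ-char← b)))

    -- The members of Z inside Γ_ℓ, for a line ℓ of Σ′: the solids
    -- ΦZ (α , i) = Φ_{m_i} α, where m_i runs over the q²+1 lines of the spread
    -- μ(S′_ℓ) of Σ; they are pairwise distinct and exhaust Z ∩ Γ_ℓ.
    module OnLine (ℓ : Line 8) (isl : IsLineOf ℓ Σ′) where
      liℓ : LinIndep ℓ
      liℓ = proj₁ isl
      hℓ : IsLine′ ℓ
      hℓ = hOf {ℓ} isl
      jℓ : ParIx q
      jℓ = proj₁ (proj₂ parP′ ℓ isl)
      jℓ-in : ℓ ∈Sp P′ jℓ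
      jℓ-in = proj₁ (proj₂ (proj₂ parP′ ℓ isl))
      jℓ-uniq : ∀ j j′ → ℓ ∈Sp P′ j → ℓ ∈Sp P′ j′ → j ≡ j′
      jℓ-uniq = proj₂ (proj₂ (proj₂ parP′ ℓ isl))

      module ThroughLine (i : SpreadIx q) = Phi ℓ liℓ hℓ (mline jℓ i) (mR jℓ i)

      Tl : Set
      Tl = C4 × SpreadIx q

      ΦZ : Tl → Solid 8
      ΦZ (α , i) = ThroughLine.Φ i α

      ΦZ⊆Γ : ∀ t → ΦZ t ⊆ Γ ℓ
      ΦZ⊆Γ (α , i) = ThroughLine.Φ⊆Γ i α

      ΦZ-InZ : ∀ t → InZ (ΦZ t)
      ΦZ-InZ (α , i) = ℓ , jℓ , isl , jℓ-in , ThroughLine.Φ-indep i α , ThroughLine.Φ⊆Γ i α , ThroughLine.Φ-notΣ i α , i ,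
                       λ v → (λ { (a , b) → ThroughLine.Φ∩Σ i α a (Σ-char→ b) }) , (λ vm → ThroughLine.m⊆Φ i α v vm , Σ-char← (ThroughLine.mΣ i vm))

      -- solids on different lines of the spread are different, since the
      -- lines of a spread are disjoint
      ΦZ-inj-ne : ∀ α i α′ i′ → i ≢ i′ → ¬ (ΦZ (α , i) ⊆ ΦZ (α′ , i′))
      ΦZ-inj-ne α i α′ i′ ne sub = 1≢0 (trans (sym (ThroughLine.n1p i)) (disj jℓ i i′ ne (ThroughLine.n1 i) n1∈i n1∈i′ (bk (ThroughLine.p i))))
        where
          n1∈i : ThroughLine.n1 i ∈⟨ mline jℓ i ⟩
          n1∈i = ThroughLine.n⊆m i (ThroughLine.n1 i) (∈-gen (mkLine (ThroughLine.n1 i) (ThroughLine.n2 i)) zero)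
          n1∈i′ : ThroughLine.n1 i ∈⟨ mline jℓ i′ ⟩
          n1∈i′ = ThroughLine.Φ∩Σ i′ α′ (sub (ThroughLine.n1 i) (∈-gen (ThroughLine.Φ i α) zero)) (ThroughLine.n1Σ i)

      ΦZ-inj : ∀ t t′ → ΦZ t ≈ ΦZ t′ → t ≡ t′
      ΦZ-inj (α , i) (α′ , i′) eq = helper (i Fin.≟ i′)
        where
          helper : Dec (i ≡ i′) → (α , i) ≡ (α′ , i′)
          helper (yes e) = cong₂ _,_ (ThroughLine.Φ-inj i α α′ (subst (λ k → ThroughLine.Φ i α ⊆ ThroughLine.Φ k α′) (sym e) (proj₁ eq))) e
          helper (no ne) = ⊥-elim (ΦZ-inj-ne α i α′ i′ ne (proj₁ eq))

      -- completeness: a member of Z inside Γ_ℓ is one of the ΦZ.  Its line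
      -- is ℓ (zLine⊆), so its spread is S′_ℓ and its line of Σ lies in μ(S′_ℓ).
      classifyZ : ∀ S → InZ S → S ⊆ Γ ℓ → Σ Tl λ t → S ≈ ΦZ t
      classifyZ S z@(ℓ′ , j , isl′ , inSp , liS , S⊆′ , notΣ , i , iff) S⊆ = (proj₁ res , i) , proj₂ res
        where
          ℓ′⊆ℓ : ℓ′ ⊆ ℓ
          ℓ′⊆ℓ = zLine⊆ ℓ isl S z S⊆
          ℓ≈ℓ′ : ℓ ≈ ℓ′
          ℓ≈ℓ′ = indepPair-spans ℓ ℓ′ (proj₁ isl′) ℓ′⊆ℓ , ℓ′⊆ℓ
          j≡ : jℓ ≡ j
          j≡ = jℓ-uniq jℓ j jℓ-in (proj₁ inSp , ≈-trans {X = ℓ} {Y = ℓ′} {Z = P′ j (proj₁ inSp)} ℓ≈ℓ′ (proj₂ inSp))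
          iff′ : ∀ v → ((v ∈⟨ S ⟩ × v ∈⟨ Σs ⟩) → v ∈⟨ mline jℓ i ⟩) × (v ∈⟨ mline jℓ i ⟩ → (v ∈⟨ S ⟩ × v ∈⟨ Σs ⟩))
          iff′ = subst (λ k → ∀ v → ((v ∈⟨ S ⟩ × v ∈⟨ Σs ⟩) → v ∈⟨ mline k i ⟩) × (v ∈⟨ mline k i ⟩ → (v ∈⟨ S ⟩ × v ∈⟨ Σs ⟩))) (sym j≡) iff
          SΣ′ : ∀ v → v ∈⟨ S ⟩ → InΣ v → v ∈⟨ mline jℓ i ⟩
          SΣ′ v a b = proj₁ (iff′ v) (a , Σ-char← b)
          mS : mline jℓ i ⊆ S
          mS v vm = proj₁ (proj₂ (iff′ v) vm)
          res : Σ C4 λ α → S ≈ ThroughLine.Φ i α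
          res = ThroughLine.Complete.result i S liS S⊆ SΣ′ mS (frontBasis ℓ S (mline jℓ i) liS S⊆ SΣ′)

  f0 f1 f2 f3 : Fin 4
  f0 = zero
  f1 = suc zero
  f2 = suc (suc zero)
  f3 = suc (suc (suc zero))

  ℓ0 : Line 8
  ℓ0 = U (fr f0) ∷ U (fr f1) ∷ []

  U-bk0 : ∀ i j → U (fr i) (bk j) ≡ 0#
  U-bk0 i j = δ-≢ (fr i) (bk j) (fr≢bk i j)

  ℓ0-li : LinIndep ℓ0
  ℓ0-li c h zero = trans (solve 2 (λ a b → a := a :* :1 :+ (b :* :0 :+ :0)) refl (c zero) (c (suc zero))) (h (fr f0))
  ℓ0-li c h (suc zero) = trans (solve 2 (λ a b → b := a :* :0 :+ (b :* :1 :+ :0)) refl (c zero) (c (suc zero))) (h (fr f1))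

  ℓ0-isl : IsLineOf ℓ0 Σ′
  ℓ0-isl = ℓ0-li , ⊆-gens {S = Σ′} {T = ℓ0} (λ { zero → ∈-gen Σ′ zero ; (suc zero) → ∈-gen Σ′ (suc zero) })

  Λ : Gens 6 8
  Λ = Γ ℓ0

  ℓ0h : IsLine′ ℓ0
  ℓ0h = U-bk0 f0 , U-bk0 f1

  Λ-li : LinIndep Λ
  Λ-li c h = λ { zero → bkc f0 ; (suc zero) → bkc f1 ; (suc (suc zero)) → bkc f2 ; (suc (suc (suc zero))) → bkc f3
               ; (suc (suc (suc (suc zero)))) → c4z ; (suc (suc (suc (suc (suc zero))))) → c5z }
    where
      c4 = c (suc (suc (suc (suc zero))))
      c5 = c (suc (suc (suc (suc (suc zero)))))
      bkc : ∀ j → c (j ↑ˡ 2) ≡ 0#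
      bkc j = trans (sym (trans (cong (_+ (c4 * U (fr f0) (bk j) + c5 * U (fr f1) (bk j))) (ΣsC-bk (λ i → c (i ↑ˡ 2)) j))
                             (trans (cong₂ (λ a b → c (j ↑ˡ 2) + (c4 * a + c5 * b)) (U-bk0 f0 j) (U-bk0 f1 j))
                               (solve 3 (λ a b d → a :+ (b :* :0 :+ d :* :0) := a) refl (c (j ↑ˡ 2)) c4 c5))))
                    (trans (sym (joinC ℓ0 c (bk j))) (h (bk j)))
      frz : ∀ j → lincomb c Λ (fr j) ≡ c4 * U (fr f0) (fr j) + c5 * U (fr f1) (fr j)
      frz j = trans (joinC ℓ0 c (fr j)) (trans (cong (_+ (c4 * U (fr f0) (fr j) + c5 * U (fr f1) (fr j))) (ΣsC-fr (λ i → c (i ↑ˡ 2)) j)) (0+ _))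
      c4z : c4 ≡ 0#
      c4z = trans (sym (*1+*0 c4 c5)) (trans (sym (frz f0)) (h (fr f0)))
      c5z : c5 ≡ 0#
      c5z = trans (sym (*0+*1 c4 c5)) (trans (sym (frz f1)) (h (fr f1)))

  Λ-23 : ∀ {v} → v ∈⟨ Λ ⟩ → v (fr f2) ≡ 0# × v (fr f3) ≡ 0#
  Λ-23 vΛ with Γ-front ℓ0 vΛ
  ... | a , b , h = trans (h f2) (*0+*0 a b)
                  , trans (h f3) (*0+*0 a b)

  Λ-intro : ∀ {v : Vect 8} → v (fr f2) ≡ 0# → v (fr f3) ≡ 0# → v ∈⟨ Λ ⟩
  Λ-intro {v} h2 h3 = Γ-intro ℓ0 ℓ0h (v (fr f0)) (v (fr f1)) λ
    { zero → sym (*1+*0 (v (fr f0)) (v (fr f1)))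
    ; (suc zero) → sym (*0+*1 (v (fr f0)) (v (fr f1)))
    ; (suc (suc zero)) → trans h2 (solve 2 (λ a b → :0 := a :* :0 :+ b :* :0) refl (v (fr f0)) (v (fr f1)))
    ; (suc (suc (suc zero))) → trans h3 (solve 2 (λ a b → :0 := a :* :0 :+ b :* :0) refl (v (fr f0)) (v (fr f1))) }

  -- no solid L(M) lies in Λ: its third row has third coordinate 1
  X-notΛ : ∀ (M : Mat) → ¬ (L M ⊆ Λ)
  X-notΛ M sub = 1≢0 (proj₁ (Λ-23 (sub (L M f2) (∈-gen (L M) f2))))

  Σs⊆Λ : Σs ⊆ Λ
  Σs⊆Λ v vΣ = Σ⊆Γ ℓ0 ℓ0h vΣ

  Uall : Gens 8 8
  Uall i = U i

  Uall-li : LinIndep Uall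
  Uall-li c h t = trans (sym (∑-δˡ 8 c t)) (h t)

  U-in-Λ-fr0 : U (fr f0) ∈⟨ Λ ⟩
  U-in-Λ-fr0 = Λ-intro refl refl
  U-in-Λ-fr1 : U (fr f1) ∈⟨ Λ ⟩
  U-in-Λ-fr1 = Λ-intro refl refl
  U-in-Λ-bk : ∀ j → U (bk j) ∈⟨ Λ ⟩
  U-in-Λ-bk j = Λ-intro (δ-≢ (bk j) (fr f2) (λ e → fr≢bk f2 j (sym e))) (δ-≢ (bk j) (fr f3) (λ e → fr≢bk f3 j (sym e)))

  -- Some generator of H has coordinates (P, Q) ≠ 0 at
  -- positions 3, 4 (otherwise H ⊆ Λ, too small); then w = P·U₃ + Q·U₄ ∈ H and
  -- H is the kernel of φ(v) = Q·v₃ - P·v₄.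
  module Hyperplane (H : Gens 7 8) (liH : LinIndep H) (ΛH : Λ ⊆ H) where

    record Wit : Set where
      field
        k : Fin 7
        nz : H k (fr f2) ≢ 0# ⊎ H k (fr f3) ≢ 0#

    findW : Wit
    findW with allZeroOr 7 (λ k → H k (fr f2))
    ... | inj₂ (k , nz) = record { k = k ; nz = inj₁ nz }
    ... | inj₁ z2 with allZeroOr 7 (λ k → H k (fr f3))
    ...   | inj₂ (k , nz) = record { k = k ; nz = inj₂ nz }
    ...   | inj₁ z3 = ⊥-elim (steinitz {7} {6} H Λ (s≤s (s≤s (s≤s (s≤s (s≤s (s≤s (s≤s z≤n))))))) (λ k → Λ-intro (z2 k) (z3 k)) liH)

    opaque
      wit : Wit
      wit = findW

    open Wit wit

    Pc Qc : Carrier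
    Pc = H k (fr f2)
    Qc = H k (fr f3)

    wv : Vect 8
    wv t = Pc * U (fr f2) t + Qc * U (fr f3) t

    -- w = P·U₃ + Q·U₄ ∈ H, since the generator differs from w by a vector of Λ
    wv∈H : wv ∈⟨ H ⟩
    wv∈H = ∈-comb H (H k ∷ x ∷ []) (1# ∷ (- 1#) ∷ []) (λ { zero → ∈-gen H k ; (suc zero) → ΛH x xΛ })
             (λ t → solve 4 (λ v p a q → p :* a :+ q := :1 :* v :+ ((:- :1) :* (v :- (p :* a :+ q)) :+ :0)) refl (H k t) Pc (U (fr f2) t) (Qc * U (fr f3) t))
      where
        x : Vect 8
        x t = H k t - wv t
        xΛ : x ∈⟨ Λ ⟩
        xΛ = Λ-intro (solve 2 (λ p q → p :- (p :* :1 :+ q :* :0) := :0) refl Pc Qc)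
                     (solve 2 (λ p q → q :- (p :* :0 :+ q :* :1) := :0) refl Pc Qc)

    φ : Vect 8 → Carrier
    φ v = Qc * v (fr f2) - Pc * v (fr f3)

    Λp : Vect 8 → Vect 8
    Λp v t = v t - (v (fr f2) * U (fr f2) t + v (fr f3) * U (fr f3) t)
    Λp∈ : ∀ v → Λp v ∈⟨ H ⟩
    Λp∈ v = ΛH (Λp v) (Λ-intro (solve 2 (λ a b → a :- (a :* :1 :+ b :* :0) := :0) refl (v (fr f2)) (v (fr f3)))
                                (solve 2 (λ a b → b :- (a :* :0 :+ b :* :1) := :0) refl (v (fr f2)) (v (fr f3))))

    -- H ⊆ ker φ: a vector of H with φ v ≠ 0 would put U₃ and U₄ into H,
    -- and then all eight unit vectors into the seven-generated H
    H-char1 : ∀ {v} → v ∈⟨ H ⟩ → φ v ≡ 0#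
    H-char1 {v} vH with φ v ≟ 0#
    ... | yes e = e
    ... | no Dnz = ⊥-elim (steinitz {8} {7} Uall H (s≤s (s≤s (s≤s (s≤s (s≤s (s≤s (s≤s (s≤s z≤n)))))))) Uin Uall-li)
      where
        D = φ v
        κ = inv D Dnz
        v2 = v (fr f2)
        v3 = v (fr f3)
        U2 : U (fr f2) ∈⟨ H ⟩
        U2 = ∈-comb H (v ∷ wv ∷ Λp v ∷ []) ((κ * Qc) ∷ (- (κ * v3)) ∷ (- (κ * Qc)) ∷ [])
               (λ { zero → vH ; (suc zero) → wv∈H ; (suc (suc zero)) → Λp∈ v })
               (λ t → begin
                  U (fr f2) t ≡⟨ sym (1* _) ⟩
                  1# * U (fr f2) t ≡⟨ cong (_* U (fr f2) t) (sym (inv-l D Dnz)) ⟩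
                  κ * D * U (fr f2) t ≡⟨ solve 9 (λ κ Q P x v2 v3 a b w → κ :* (Q :* v2 :- P :* v3) :* a
                                           := (κ :* Q) :* x :+ ((:- (κ :* v3)) :* (P :* a :+ Q :* b) :+ ((:- (κ :* Q)) :* (x :- (v2 :* a :+ v3 :* b)) :+ :0))) refl
                                           κ Qc Pc (v t) v2 v3 (U (fr f2) t) (U (fr f3) t) (wv t) ⟩
                  _ ∎)
          where open ≡-Reasoning
        U3 : U (fr f3) ∈⟨ H ⟩
        U3 = ∈-comb H (v ∷ wv ∷ Λp v ∷ []) ((- (κ * Pc)) ∷ (κ * v2) ∷ (κ * Pc) ∷ [])
               (λ { zero → vH ; (suc zero) → wv∈H ; (suc (suc zero)) → Λp∈ v })
               (λ t → begin
                  U (fr f3) t ≡⟨ sym (1* _) ⟩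
                  1# * U (fr f3) t ≡⟨ cong (_* U (fr f3) t) (sym (inv-l D Dnz)) ⟩
                  κ * D * U (fr f3) t ≡⟨ solve 9 (λ κ Q P x v2 v3 a b w → κ :* (Q :* v2 :- P :* v3) :* b
                                           := (:- (κ :* P)) :* x :+ ((κ :* v2) :* (P :* a :+ Q :* b) :+ ((κ :* P) :* (x :- (v2 :* a :+ v3 :* b)) :+ :0))) refl
                                           κ Qc Pc (v t) v2 v3 (U (fr f2) t) (U (fr f3) t) (wv t) ⟩
                  _ ∎)
          where open ≡-Reasoning
        Uin : ∀ i → Uall i ∈⟨ H ⟩
        Uin i with split8 i
        ... | isBk j = ΛH _ (U-in-Λ-bk j)
        ... | isFr zero = ΛH _ U-in-Λ-fr0
        ... | isFr (suc zero) = ΛH _ U-in-Λ-fr1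
        ... | isFr (suc (suc zero)) = U2
        ... | isFr (suc (suc (suc zero))) = U3

    -- coefficients with pn·P + qn·Q = 1, used to write v ∈ ker φ as a Λ-vector plus ρ(v)·w
    record Norm : Set where
      field
        pn qn : Carrier
        pq1 : pn * Pc + qn * Qc ≡ 1#

    norm : Norm
    norm with nz
    ... | inj₁ pnz = record { pn = inv Pc pnz ; qn = 0# ; pq1 = trans (cong₂ _+_ (inv-l Pc pnz) (0* Qc)) (+0 1#) }
    ... | inj₂ qnz = record { pn = 0# ; qn = inv Qc qnz ; pq1 = trans (cong₂ _+_ (0* Pc) (inv-l Qc qnz)) (0+ 1#) }

    open Norm norm

    ρ : Vect 8 → Carrier
    ρ v = pn * v (fr f2) + qn * v (fr f3)

    ρ2 : ∀ v → φ v ≡ 0# → v (fr f2) ≡ ρ v * Pc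
    ρ2 v e = begin
        v2 ≡⟨ sym (*1 v2) ⟩
        v2 * 1# ≡⟨ cong (v2 *_) (sym pq1) ⟩
        v2 * (pn * Pc + qn * Qc) ≡⟨ solve 5 (λ v2 p q P Q → v2 :* (p :* P :+ q :* Q) := p :* P :* v2 :+ q :* (Q :* v2)) refl v2 pn qn Pc Qc ⟩
        pn * Pc * v2 + qn * (Qc * v2) ≡⟨ cong (λ s → pn * Pc * v2 + qn * s) (minus0 _ _ e) ⟩
        pn * Pc * v2 + qn * (Pc * v3) ≡⟨ solve 5 (λ v2 v3 p q P → p :* P :* v2 :+ q :* (P :* v3) := (p :* v2 :+ q :* v3) :* P) refl v2 v3 pn qn Pc ⟩
        ρ v * Pc ∎
      where open ≡-Reasoning
            v2 = v (fr f2)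
            v3 = v (fr f3)

    ρ3 : ∀ v → φ v ≡ 0# → v (fr f3) ≡ ρ v * Qc
    ρ3 v e = begin
        v3 ≡⟨ sym (*1 v3) ⟩
        v3 * 1# ≡⟨ cong (v3 *_) (sym pq1) ⟩
        v3 * (pn * Pc + qn * Qc) ≡⟨ solve 5 (λ v3 p q P Q → v3 :* (p :* P :+ q :* Q) := p :* (P :* v3) :+ q :* Q :* v3) refl v3 pn qn Pc Qc ⟩
        pn * (Pc * v3) + qn * Qc * v3 ≡⟨ cong (λ s → pn * s + qn * Qc * v3) (sym (minus0 _ _ e)) ⟩
        pn * (Qc * v2) + qn * Qc * v3 ≡⟨ solve 5 (λ v2 v3 p q Q → p :* (Q :* v2) :+ q :* Q :* v3 := (p :* v2 :+ q :* v3) :* Q) refl v2 v3 pn qn Qc ⟩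
        ρ v * Qc ∎
      where open ≡-Reasoning
            v2 = v (fr f2)
            v3 = v (fr f3)

    H-char2 : ∀ {v : Vect 8} → φ v ≡ 0# → v ∈⟨ H ⟩
    H-char2 {v} e = ∈-comb H (x ∷ wv ∷ []) (1# ∷ ρ v ∷ []) (λ { zero → ΛH x xΛ ; (suc zero) → wv∈H })
                      (λ t → solve 3 (λ a r w → a := :1 :* (a :- r :* w) :+ (r :* w :+ :0)) refl (v t) (ρ v) (wv t))
      where
        x : Vect 8
        x t = v t - ρ v * wv t
        xΛ : x ∈⟨ Λ ⟩
        xΛ = Λ-intro (trans (cong (λ s → s - ρ v * wv (fr f2)) (ρ2 v e)) (solve 3 (λ r P Q → r :* P :- r :* (P :* :1 :+ Q :* :0) := :0) refl (ρ v) Pc Qc))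
                     (trans (cong (λ s → s - ρ v * wv (fr f3)) (ρ3 v e)) (solve 3 (λ r P Q → r :* Q :- r :* (P :* :0 :+ Q :* :1) := :0) refl (ρ v) Pc Qc))

    PQnz : ¬ (Pc ≡ 0# × Qc ≡ 0#)
    PQnz (p0 , q0) with nz
    ... | inj₁ x = x p0
    ... | inj₂ x = x q0

    -- no solid L(M) lies in H: its 3rd and 4th rows have φ-values Q and -P
    X-notH : ∀ (M : Mat) → ¬ (L M ⊆ H)
    X-notH M sub = PQnz (p0 , q0)
      where
        r2 = H-char1 (sub (L M f2) (∈-gen (L M) f2))
        r3 = H-char1 (sub (L M f3) (∈-gen (L M) f3))
        q0 : Qc ≡ 0#
        q0 = trans (solve 2 (λ Q P → Q := Q :* :1 :- P :* :0) refl Qc Pc) r2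
        p0 : Pc ≡ 0#
        p0 = trans (sym (solve 1 (λ P → :- (:- P) := P) refl Pc)) (trans (cong -_ (trans (solve 2 (λ Q P → :- P := Q :* :0 :- P :* :1) refl Qc Pc) r3)) (solve 0 (:- :0 := :0) refl))

    -- Its vectors are the Σ′-vectors a·U₁ + b·U₂ + c·w
    -- with coordinates planeCoords v = (a, b, c).

    b0 b1 : Vect 8
    b0 = U (fr f0)
    b1 = U (fr f1)

    planeVector : C3 → Vect 8
    planeVector x t = proj₁ x * b0 t + proj₁ (proj₂ x) * b1 t + proj₂ (proj₂ x) * wv t

    planeCoords : Vect 8 → C3
    planeCoords v = v (fr f0) , v (fr f1) , ρ v

    tri : ∀ {a b c a′ b′ c′ : Carrier} → a ≡ a′ → b ≡ b′ → c ≡ c′ → (a , b , c) ≡ (a′ , b′ , c′)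
    tri a b c = cong₂ _,_ a (cong₂ _,_ b c)

    planeCoords-vector : ∀ x → planeCoords (planeVector x) ≡ x
    planeCoords-vector (a , b , c) = tri
      (solve 5 (λ a b c P Q → a :* :1 :+ b :* :0 :+ c :* (P :* :0 :+ Q :* :0) := a) refl a b c Pc Qc)
      (solve 5 (λ a b c P Q → a :* :0 :+ b :* :1 :+ c :* (P :* :0 :+ Q :* :0) := b) refl a b c Pc Qc)
      (trans (solve 7 (λ a b c P Q p q → p :* (a :* :0 :+ b :* :0 :+ c :* (P :* :1 :+ Q :* :0))
                                     :+ q :* (a :* :0 :+ b :* :0 :+ c :* (P :* :0 :+ Q :* :1))
                                     := c :* (p :* P :+ q :* Q)) refl a b c Pc Qc pn qn)
             (trans (cong (c *_) pq1) (*1 c)))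

    planeCoords-resp : ∀ {v w : Vect 8} → v ≐ w → planeCoords v ≡ planeCoords w
    planeCoords-resp e = tri (e (fr f0)) (e (fr f1)) (cong₂ (λ s t → pn * s + qn * t) (e (fr f2)) (e (fr f3)))

    planeVector-Σ′ : ∀ x → InΣ′ (planeVector x)
    planeVector-Σ′ (a , b , c) j = trans (cong₂ (λ s t → a * s + b * t + c * (Pc * U (fr f2) (bk j) + Qc * U (fr f3) (bk j))) (U-bk0 f0 j) (U-bk0 f1 j))
                          (trans (cong₂ (λ s t → a * 0# + b * 0# + c * (Pc * s + Qc * t)) (U-bk0 f2 j) (U-bk0 f3 j))
                            (solve 5 (λ a b c P Q → a :* :0 :+ b :* :0 :+ c :* (P :* :0 :+ Q :* :0) := :0) refl a b c Pc Qc))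

    planeVector∈H : ∀ x → planeVector x ∈⟨ H ⟩
    planeVector∈H (a , b , c) = ∈-comb H (b0 ∷ b1 ∷ wv ∷ []) (a ∷ b ∷ c ∷ [])
                         (λ { zero → ΛH _ U-in-Λ-fr0 ; (suc zero) → ΛH _ U-in-Λ-fr1 ; (suc (suc zero)) → wv∈H })
                         (λ t → solve 6 (λ a b c x y z → a :* x :+ b :* y :+ c :* z := a :* x :+ (b :* y :+ (c :* z :+ :0))) refl a b c (b0 t) (b1 t) (wv t))

    planeLine : PlaneLine → Line 8
    planeLine k = planeVector (linePt₀ k) ∷ planeVector (linePt₁ k) ∷ []

    lin-comb : ∀ k (c : Fin 2 → Carrier) t → lincomb c (planeLine k) t ≡ planeVector (comb3 (c zero) (c (suc zero)) (linePt₀ k) (linePt₁ k)) t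
    lin-comb k c t = solve 11 (λ c0 c1 x1 x2 x3 y1 y2 y3 p q r →
                        c0 :* (x1 :* p :+ x2 :* q :+ x3 :* r) :+ (c1 :* (y1 :* p :+ y2 :* q :+ y3 :* r) :+ :0)
                        := (c0 :* x1 :+ c1 :* y1) :* p :+ (c0 :* x2 :+ c1 :* y2) :* q :+ (c0 :* x3 :+ c1 :* y3) :* r) refl
                       (c zero) (c (suc zero)) (proj₁ (linePt₀ k)) (proj₁ (proj₂ (linePt₀ k))) (proj₂ (proj₂ (linePt₀ k)))
                       (proj₁ (linePt₁ k)) (proj₁ (proj₂ (linePt₁ k))) (proj₂ (proj₂ (linePt₁ k))) (b0 t) (b1 t) (wv t)

    planeCoords-zero : ∀ {v : Vect 8} → (∀ t → v t ≡ 0#) → planeCoords v ≡ (0# , 0# , 0#)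
    planeCoords-zero {v} h = tri (h (fr f0)) (h (fr f1)) (trans (cong₂ (λ s t → pn * s + qn * t) (h (fr f2)) (h (fr f3))) (*0+*0 pn qn))

    comb-eq : ∀ k c → (∀ t → lincomb c (planeLine k) t ≡ 0#) → comb3 (c zero) (c (suc zero)) (linePt₀ k) (linePt₁ k) ≡ (0# , 0# , 0#)
    comb-eq k c h = trans (sym (planeCoords-vector _)) (trans (planeCoords-resp (λ t → sym (lin-comb k c t))) (planeCoords-zero h))

    p1 : ∀ {a b c a′ b′ c′ : Carrier} → (a , b , c) ≡ (a′ , b′ , c′) → a ≡ a′
    p1 = cong proj₁
    p2 : ∀ {a b c a′ b′ c′ : Carrier} → (a , b , c) ≡ (a′ , b′ , c′) → b ≡ b′
    p2 = cong (λ v → proj₁ (proj₂ v))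
    p3 : ∀ {a b c a′ b′ c′ : Carrier} → (a , b , c) ≡ (a′ , b′ , c′) → c ≡ c′
    p3 = cong (λ v → proj₂ (proj₂ v))

    planeLine-li : ∀ k → LinIndep (planeLine k)
    planeLine-li (inj₁ (inj₁ (a , b))) c h = λ { zero → trans (sym (*1+*0 (c zero) (c (suc zero)))) (p2 e)
                                          ; (suc zero) → trans (sym (*0+*1 (c zero) (c (suc zero)))) (p3 e) }
      where e = comb-eq (inj₁ (inj₁ (a , b))) c h
    planeLine-li (inj₁ (inj₂ cc)) c h = λ { zero → trans (sym (*1+*0 (c zero) (c (suc zero)))) (p1 e)
                                     ; (suc zero) → trans (sym (*0+*1 (c zero) (c (suc zero)))) (p3 e) }
      where e = comb-eq (inj₁ (inj₂ cc)) c h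
    planeLine-li (inj₂ tt) c h = λ { zero → trans (sym (*1+*0 (c zero) (c (suc zero)))) (p1 e)
                              ; (suc zero) → trans (sym (*0+*1 (c zero) (c (suc zero)))) (p2 e) }
      where e = comb-eq (inj₂ tt) c h

    planeLine-isl : ∀ k → IsLineOf (planeLine k) Σ′
    planeLine-isl k = planeLine-li k , ⊆-gens {S = Σ′} {T = planeLine k} (λ { zero → Σ′-char← (planeVector-Σ′ (linePt₀ k)) ; (suc zero) → Σ′-char← (planeVector-Σ′ (linePt₁ k)) })

    planeLine⊆H : ∀ k → planeLine k ⊆ H
    planeLine⊆H k = ⊆-gens {S = H} {T = planeLine k} (λ { zero → planeVector∈H (linePt₀ k) ; (suc zero) → planeVector∈H (linePt₁ k) })

    inLine : ∀ k {v} → v ∈⟨ planeLine k ⟩ → dot3 (lineForm k) (planeCoords v) ≡ 0#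
    inLine k {v} (c , h) = begin
        dot3 (lineForm k) (planeCoords v) ≡⟨ cong (dot3 (lineForm k)) (sym (trans (planeCoords-resp (λ t → trans (sym (lin-comb k c t)) (h t))) refl)) ⟩
        dot3 (lineForm k) (planeCoords (planeVector (comb3 (c zero) (c (suc zero)) (linePt₀ k) (linePt₁ k)))) ≡⟨ cong (dot3 (lineForm k)) (planeCoords-vector _) ⟩
        dot3 (lineForm k) (comb3 (c zero) (c (suc zero)) (linePt₀ k) (linePt₁ k)) ≡⟨ dot3-comb (lineForm k) (c zero) (c (suc zero)) (linePt₀ k) (linePt₁ k) ⟩
        c zero * dot3 (lineForm k) (linePt₀ k) + c (suc zero) * dot3 (lineForm k) (linePt₁ k) ≡⟨ cong₂ (λ s t → c zero * s + c (suc zero) * t) (fx0 k) (fy0 k) ⟩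
        c zero * 0# + c (suc zero) * 0# ≡⟨ *0+*0 (c zero) (c (suc zero)) ⟩
        0# ∎
      where open ≡-Reasoning

    planeLine-inj : ∀ k k′ → planeLine k ⊆ planeLine k′ → k ≡ k′
    planeLine-inj k k′ sub = lineForm-unique k k′ (trans (cong (dot3 (lineForm k′)) (sym (planeCoords-vector (linePt₀ k)))) (inLine k′ (sub _ (∈-gen (planeLine k) zero))))
                                  (trans (cong (dot3 (lineForm k′)) (sym (planeCoords-vector (linePt₁ k)))) (inLine k′ (sub _ (∈-gen (planeLine k) (suc zero)))))

    plane-dec : ∀ {u : Vect 8} → InΣ′ u → φ u ≡ 0# → ∀ t → u t ≡ planeVector (planeCoords u) t
    plane-dec {u} hu e t = go t (split8 t)
      where
        r = ρ u
        go : ∀ t → Split8 t → u t ≡ planeVector (planeCoords u) t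
        go .(fr zero) (isFr zero) = solve 5 (λ a b c P Q → a := a :* :1 :+ b :* :0 :+ c :* (P :* :0 :+ Q :* :0)) refl (u (fr f0)) (u (fr f1)) r Pc Qc
        go .(fr (suc zero)) (isFr (suc zero)) = solve 5 (λ a b c P Q → b := a :* :0 :+ b :* :1 :+ c :* (P :* :0 :+ Q :* :0)) refl (u (fr f0)) (u (fr f1)) r Pc Qc
        go .(fr (suc (suc zero))) (isFr (suc (suc zero))) = trans (ρ2 u e) (solve 5 (λ a b c P Q → c :* P := a :* :0 :+ b :* :0 :+ c :* (P :* :1 :+ Q :* :0)) refl (u (fr f0)) (u (fr f1)) r Pc Qc)
        go .(fr (suc (suc (suc zero)))) (isFr (suc (suc (suc zero)))) = trans (ρ3 u e) (solve 5 (λ a b c P Q → c :* Q := a :* :0 :+ b :* :0 :+ c :* (P :* :0 :+ Q :* :1)) refl (u (fr f0)) (u (fr f1)) r Pc Qc)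
        go .(bk j) (isBk j) = trans (hu j) (sym (planeVector-Σ′ (planeCoords u) j))

    kernel-member : ∀ k x → dot3 (lineForm k) x ≡ 0# → planeVector x ∈⟨ planeLine k ⟩
    kernel-member (inj₁ (inj₁ (a , b))) (α , β , γ) e = (β ∷ γ ∷ []) , λ t → begin
        β * ((- a) * b0 t + 1# * b1 t + 0# * wv t) + (γ * ((- b) * b0 t + 0# * b1 t + 1# * wv t) + 0#)
          ≡⟨ solve 8 (λ α β γ a b p q r → β :* ((:- a) :* p :+ :1 :* q :+ :0 :* r) :+ (γ :* ((:- b) :* p :+ :0 :* q :+ :1 :* r) :+ :0)
                       := α :* p :+ β :* q :+ γ :* r :- (:1 :* α :+ a :* β :+ b :* γ) :* p) refl α β γ a b (b0 t) (b1 t) (wv t) ⟩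
        α * b0 t + β * b1 t + γ * wv t - (1# * α + a * β + b * γ) * b0 t ≡⟨ cong (λ s → α * b0 t + β * b1 t + γ * wv t - s * b0 t) e ⟩
        α * b0 t + β * b1 t + γ * wv t - 0# * b0 t ≡⟨ solve 2 (λ x p → x :- :0 :* p := x) refl (α * b0 t + β * b1 t + γ * wv t) (b0 t) ⟩
        planeVector (α , β , γ) t ∎
      where open ≡-Reasoning
    kernel-member (inj₁ (inj₂ c)) (α , β , γ) e = (α ∷ γ ∷ []) , λ t → begin
        α * (1# * b0 t + 0# * b1 t + 0# * wv t) + (γ * (0# * b0 t + (- c) * b1 t + 1# * wv t) + 0#)
          ≡⟨ solve 7 (λ α β γ c p q r → α :* (:1 :* p :+ :0 :* q :+ :0 :* r) :+ (γ :* (:0 :* p :+ (:- c) :* q :+ :1 :* r) :+ :0)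
                       := α :* p :+ β :* q :+ γ :* r :- (:0 :* α :+ :1 :* β :+ c :* γ) :* q) refl α β γ c (b0 t) (b1 t) (wv t) ⟩
        α * b0 t + β * b1 t + γ * wv t - (0# * α + 1# * β + c * γ) * b1 t ≡⟨ cong (λ s → α * b0 t + β * b1 t + γ * wv t - s * b1 t) e ⟩
        α * b0 t + β * b1 t + γ * wv t - 0# * b1 t ≡⟨ solve 2 (λ x p → x :- :0 :* p := x) refl (α * b0 t + β * b1 t + γ * wv t) (b1 t) ⟩
        planeVector (α , β , γ) t ∎
      where open ≡-Reasoning
    kernel-member (inj₂ tt) (α , β , γ) e = (α ∷ β ∷ []) , λ t → begin
        α * (1# * b0 t + 0# * b1 t + 0# * wv t) + (β * (0# * b0 t + 1# * b1 t + 0# * wv t) + 0#)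
          ≡⟨ solve 6 (λ α β γ p q r → α :* (:1 :* p :+ :0 :* q :+ :0 :* r) :+ (β :* (:0 :* p :+ :1 :* q :+ :0 :* r) :+ :0)
                       := α :* p :+ β :* q :+ γ :* r :- (:0 :* α :+ :0 :* β :+ :1 :* γ) :* r) refl α β γ (b0 t) (b1 t) (wv t) ⟩
        α * b0 t + β * b1 t + γ * wv t - (0# * α + 0# * β + 1# * γ) * wv t ≡⟨ cong (λ s → α * b0 t + β * b1 t + γ * wv t - s * wv t) e ⟩
        α * b0 t + β * b1 t + γ * wv t - 0# * wv t ≡⟨ solve 2 (λ x p → x :- :0 :* p := x) refl (α * b0 t + β * b1 t + γ * wv t) (wv t) ⟩
        planeVector (α , β , γ) t ∎
      where open ≡-Reasoning

    -- every line of Σ′ inside H is one of the planeLine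
    -- Every line ⟨u₀, u₁⟩ of Σ′ inside H is contained in a plane line: the
    -- plane coordinates of u₀, u₁ have a nonzero common annihilator (2 < 3),
    -- whose normal form is the equation of the line.
    planeLineThrough : ∀ (u : Line 8) → IsLine′ u → u zero ∈⟨ H ⟩ → u (suc zero) ∈⟨ H ⟩ → Σ PlaneLine λ kℓ → u ⊆ planeLine kℓ
    planeLineThrough u (h0 , h1) u0H u1H = kℓ , ⊆-gens {S = planeLine kℓ} {T = u} (λ { zero → mem (u zero) h0 u0H (ker zero) ; (suc zero) → mem (u (suc zero)) h1 u1H (ker (suc zero)) })
      where
        Cm : Fin 3 → Fin 2 → Carrier
        Cm zero s = u s (fr f0)
        Cm (suc zero) s = u s (fr f1)
        Cm (suc (suc zero)) s = ρ (u s)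
        mf = leftKernel 2 3 (s≤s (s≤s (s≤s z≤n))) Cm
        f = proj₁ mf
        fv : C3
        fv = f zero , f (suc zero) , f (suc (suc zero))
        fnz : ¬ (proj₁ fv ≡ 0# × proj₁ (proj₂ fv) ≡ 0# × proj₂ (proj₂ fv) ≡ 0#)
        fnz (a , b , c) with proj₂ (proj₂ mf)
        ... | zero , nz = nz a
        ... | suc zero , nz = nz b
        ... | suc (suc zero) , nz = nz c
        nf = normaliseForm fv fnz
        kℓ = proj₁ nf
        ker : ∀ s → dot3 (lineForm kℓ) (planeCoords (u s)) ≡ 0#
        ker s = proj₂ nf (planeCoords (u s)) (trans (solve 6 (λ a b c x y z → a :* x :+ b :* y :+ c :* z := a :* x :+ (b :* y :+ (c :* z :+ :0))) refl
                                               (f zero) (f (suc zero)) (f (suc (suc zero))) (u s (fr f0)) (u s (fr f1)) (ρ (u s)))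
                                       (proj₁ (proj₂ mf) s))
        mem : ∀ v → InΣ′ v → v ∈⟨ H ⟩ → dot3 (lineForm kℓ) (planeCoords v) ≡ 0# → v ∈⟨ planeLine kℓ ⟩
        mem v hv vH e = ∈-resp {g = planeLine kℓ} (λ t → sym (plane-dec {v} hv (H-char1 {v} vH) t)) (kernel-member kℓ (planeCoords v) e)


-- Counting.  A type T has N elements when T ↔ Fin N; sums and products are
-- counted with the library bijections Fin (m + n) ↔ Fin m ⊎ Fin n and
-- Fin (m * n) ↔ Fin m × Fin n.
module Counting where
  open import Function.Properties.Inverse using (↔-refl; ↔-sym; ↔-trans)
  open import Data.Sum.Function.Propositional using (_⊎-↔_)
  open import Data.Product.Function.NonDependent.Propositional using (_×-↔_)

  count-⊤ : ⊤ ↔ Fin 1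
  count-⊤ = ↔-sym FinP.1↔⊤

  count-Fin : ∀ n → Fin n ↔ Fin n
  count-Fin n = ↔-refl

  count-⊎ : ∀ {A B : Set} {a b} → A ↔ Fin a → B ↔ Fin b → (A ⊎ B) ↔ Fin (a +ℕ b)
  count-⊎ EA EB = ↔-trans (EA ⊎-↔ EB) (↔-sym FinP.+↔⊎)

  count-× : ∀ {A B : Set} {a b} → A ↔ Fin a → B ↔ Fin b → (A × B) ↔ Fin (a *ℕ b)
  count-× EA EB = ↔-trans (EA ×-↔ EB) (↔-sym FinP.*↔×)

open Counting

count-Λ : ∀ q → q *ℕ (q *ℕ (q *ℕ q)) *ℕ (1 +ℕ q *ℕ q) +ℕ 1 ≡ q ^ℕ 4 *ℕ (q ^ℕ 2 +ℕ 1) +ℕ 1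
count-Λ = solve 1 (λ q → q :* (q :* (q :* q)) :* (con 1 :+ q :* q) :+ con 1 := q :^ 4 :* (q :^ 2 :+ con 1) :+ con 1) refl
  where open +-*-Solver

count-H : ∀ q → q *ℕ (q *ℕ (q *ℕ q)) *ℕ (1 +ℕ q *ℕ q) *ℕ ((q *ℕ q +ℕ q) +ℕ 1) +ℕ 1 ≡ q ^ℕ 4 *ℕ (q ^ℕ 2 +ℕ 1) *ℕ (q ^ℕ 2 +ℕ q +ℕ 1) +ℕ 1
count-H = solve 1 (λ q → q :* (q :* (q :* q)) :* (con 1 :+ q :* q) :* ((q :* q :+ q) :+ con 1) :+ con 1 := q :^ 4 :* (q :^ 2 :+ con 1) :* (q :^ 2 :+ q :+ con 1) :+ con 1) refl
  where open +-*-Solver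

decidableEquality : ∀ (F : Field) q → HasOrder F q → DecidableEquality (Field.Carrier F)
decidableEquality F q iso x y with Inverse.to iso x Fin.≟ Inverse.to iso y
... | yes e = yes (trans (sym (Inverse.strictlyInverseʳ iso x)) (trans (cong (Inverse.from iso) e) (Inverse.strictlyInverseʳ iso y)))
... | no ne = no (λ e → ne (cong (Inverse.to iso) e))

module Proof (F : Field) (q : ℕ) (iso : HasOrder F q)
             (A : Fin (q ^ℕ 12) → Geometry.Mat F)
             (P : Geometry.Parallelism F q 8) (parP : Geometry.IsParallelism F q (Geometry.Σs F) P)
             (P′ : Geometry.Parallelism F q 8) (parP′ : Geometry.IsParallelism F q (Geometry.Σ′ F) P′)
             (μ : Permutation′ (suc (q *ℕ q +ℕ q))) where
  open OverField F (decidableEquality F q iso) public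
  open Config q A P P′ parP parP′ μ

  countMembers : ∀ {k} {T : Set} {N} (W : Gens k 8) → T ↔ Fin N → (Φ : T → Solid 8) →
                 (∀ t → Member (Φ t) × Φ t ⊆ W) → (∀ t t′ → Φ t ≈ Φ t′ → t ≡ t′) →
                 (∀ S → Member S → S ⊆ W → Σ T λ t → S ≈ Φ t) → ContainsExactly N W
  countMembers W E Φ members distinct complete =
    (λ i → Φ (from i)) , (λ i → members (from i)) ,
    (λ i j eq → trans (sym (strictlyInverseˡ i)) (trans (cong to (distinct _ _ eq)) (strictlyInverseˡ j))) ,
    λ S mS sub → let (t , S≈Φt) = complete S mS sub in
                 to t , subst (λ z → S ≈ Φ z) (sym (strictlyInverseʳ t)) S≈Φt
    where open Inverse E

  count-ZΓ : (C4 × SpreadIx q) ↔ Fin (q *ℕ (q *ℕ (q *ℕ q)) *ℕ suc (q *ℕ q))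
  count-ZΓ = count-× (count-× iso (count-× iso (count-× iso iso))) (count-Fin _)

  count-PlaneLine : PlaneLine ↔ Fin ((q *ℕ q +ℕ q) +ℕ 1)
  count-PlaneLine = count-⊎ (count-⊎ (count-× iso iso) iso) count-⊤

  Z-notΣ : ∀ {S} → InZ S → ¬ (S ≈ Σs)
  Z-notΣ (ℓ′ , j , isl′ , inSp , liS , S⊆′ , notΣ , i , iff) = notΣ

  -- Λ = Γ_ℓ₀ contains Σ and the q⁴(q²+1) members of Z_ℓ₀, and nothing else:
  -- no L(A) lies in Λ, and a member of Z inside Γ_ℓ₀ belongs to Z_ℓ₀.
  module OnΛ = OnLine ℓ0 ℓ0-isl

  ΛContains : ContainsExactly (q ^ℕ 4 *ℕ (q ^ℕ 2 +ℕ 1) +ℕ 1) Λ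
  ΛContains = subst (λ N → ContainsExactly N Λ) (count-Λ q)
                (countMembers Λ (count-⊎ count-ZΓ count-⊤) ΦΛ members distinct complete)
    where
      ΦΛ : (C4 × SpreadIx q) ⊎ ⊤ → Solid 8
      ΦΛ (inj₁ t)  = OnΛ.ΦZ t
      ΦΛ (inj₂ tt) = Σs
      members : ∀ t → Member (ΦΛ t) × ΦΛ t ⊆ Λ
      members (inj₁ t)  = inj₂ (inj₁ (OnΛ.ΦZ-InZ t)) , OnΛ.ΦZ⊆Γ t
      members (inj₂ tt) = inj₂ (inj₂ (≈-refl {X = Σs})) , Σs⊆Λ
      distinct : ∀ t t′ → ΦΛ t ≈ ΦΛ t′ → t ≡ t′
      distinct (inj₁ t)  (inj₁ t′) x = cong inj₁ (OnΛ.ΦZ-inj t t′ x)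
      distinct (inj₁ t)  (inj₂ tt) x = ⊥-elim (Z-notΣ {S = OnΛ.ΦZ t} (OnΛ.ΦZ-InZ t) x)
      distinct (inj₂ tt) (inj₁ t)  x = ⊥-elim (Z-notΣ {S = OnΛ.ΦZ t} (OnΛ.ΦZ-InZ t) (≈-sym {X = Σs} {Y = OnΛ.ΦZ t} x))
      distinct (inj₂ tt) (inj₂ tt) x = refl
      complete : ∀ S → Member S → S ⊆ Λ → Σ ((C4 × SpreadIx q) ⊎ ⊤) λ t → S ≈ ΦΛ t
      complete S (inj₁ (k , S≈L)) sub = ⊥-elim (X-notΛ (A k) (⊆-trans {A = L (A k)} {B = S} {C = Λ} (proj₂ S≈L) sub))
      complete S (inj₂ (inj₁ z)) sub  = let (t , S≈) = OnΛ.classifyZ S z sub in inj₁ t , S≈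
      complete S (inj₂ (inj₂ e)) sub  = inj₂ tt , e

  -- A hyperplane H ⊇ Λ contains Σ and, for each of the q²+q+1 lines ℓ of the
  -- plane H ∩ Σ′, the q⁴(q²+1) members of Z_ℓ; nothing else.
  module AtHyperplane (H : Gens 7 8) (liH : LinIndep H) (ΛH : Λ ⊆ H) where
    open Hyperplane H liH ΛH

    module OnPlaneLine (k : PlaneLine) = OnLine (planeLine k) (planeLine-isl k)

    Γk⊆H : ∀ k → Γ (planeLine k) ⊆ H
    Γk⊆H k = Γ⊆ {W = H} (planeLine k) (⊆-trans {A = Σs} {B = Λ} {C = H} Σs⊆Λ ΛH) (planeLine⊆H k)

    -- a member of Z inside H is built on a line of the plane H ∩ Σ′: H is cut
    -- out by a condition on the front, and the front basis of the member has
    -- the fronts of its line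
    zLineInPlane : ∀ S → (z : InZ S) → S ⊆ H → Σ PlaneLine λ k → proj₁ z ⊆ planeLine k
    zLineInPlane S (ℓ′ , j , isl′ , inSp , liS , S⊆′ , notΣ , i , iff) sub = planeLineThrough ℓ′ (hOf {ℓ′} isl′) u0H u1H
      where
        open FrontBasis (frontBasis ℓ′ S (P (μ ⟨$⟩ʳ j) i) liS S⊆′ (λ v a b → proj₁ (iff v) (a , Σ-char← b)))
        s-eq : ∀ j → s (fr j) ≡ ℓ′ zero (fr j)
        s-eq j = trans (sF j) (1*+0* (ℓ′ zero (fr j)) (ℓ′ (suc zero) (fr j)))
        t-eq : ∀ j → t (fr j) ≡ ℓ′ (suc zero) (fr j)
        t-eq j = trans (tF j) (0*+1* (ℓ′ zero (fr j)) (ℓ′ (suc zero) (fr j)))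
        u0H : ℓ′ zero ∈⟨ H ⟩
        u0H = H-char2 (trans (cong₂ (λ a b → Qc * a - Pc * b) (sym (s-eq f2)) (sym (s-eq f3))) (H-char1 (sub s s∈)))
        u1H : ℓ′ (suc zero) ∈⟨ H ⟩
        u1H = H-char2 (trans (cong₂ (λ a b → Qc * a - Pc * b) (sym (t-eq f2)) (sym (t-eq f3))) (H-char1 (sub t t∈)))

    HContains : ContainsExactly (q ^ℕ 4 *ℕ (q ^ℕ 2 +ℕ 1) *ℕ (q ^ℕ 2 +ℕ q +ℕ 1) +ℕ 1) H
    HContains = subst (λ N → ContainsExactly N H) (count-H q)
                  (countMembers H (count-⊎ (count-× count-ZΓ count-PlaneLine) count-⊤) ΦH members distinct complete)
      where
        ΦH : ((C4 × SpreadIx q) × PlaneLine) ⊎ ⊤ → Solid 8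
        ΦH (inj₁ (t , k)) = OnPlaneLine.ΦZ k t
        ΦH (inj₂ tt)      = Σs
        members : ∀ t → Member (ΦH t) × ΦH t ⊆ H
        members (inj₁ (t , k)) = inj₂ (inj₁ (OnPlaneLine.ΦZ-InZ k t)) ,
                                 ⊆-trans {A = OnPlaneLine.ΦZ k t} {B = Γ (planeLine k)} {C = H} (OnPlaneLine.ΦZ⊆Γ k t) (Γk⊆H k)
        members (inj₂ tt)      = inj₂ (inj₂ (≈-refl {X = Σs})) , ⊆-trans {A = Σs} {B = Λ} {C = H} Σs⊆Λ ΛH
        -- a member of Z_ℓ inside Γ_ℓ′ has ℓ ⊆ ℓ′, so different plane lines give different solids
        sameLine : ∀ k k′ t t′ → OnPlaneLine.ΦZ k t ⊆ OnPlaneLine.ΦZ k′ t′ → k ≡ k′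
        sameLine k k′ t t′ sub = planeLine-inj k k′
          (zLine⊆ (planeLine k′) (planeLine-isl k′) (OnPlaneLine.ΦZ k t) (OnPlaneLine.ΦZ-InZ k t)
                  (⊆-trans {A = OnPlaneLine.ΦZ k t} {B = OnPlaneLine.ΦZ k′ t′} {C = Γ (planeLine k′)} sub (OnPlaneLine.ΦZ⊆Γ k′ t′)))
        distinct : ∀ t t′ → ΦH t ≈ ΦH t′ → t ≡ t′
        distinct (inj₁ (t , k)) (inj₁ (t′ , k′)) x = sameIndex (sameLine k k′ t t′ (proj₁ x))
          where
            sameIndex : k ≡ k′ → inj₁ (t , k) ≡ inj₁ (t′ , k′)
            sameIndex e = cong inj₁ (cong₂ _,_ (OnPlaneLine.ΦZ-inj k t t′ (subst (λ z → OnPlaneLine.ΦZ k t ≈ OnPlaneLine.ΦZ z t′) (sym e) x)) e)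
        distinct (inj₁ (t , k)) (inj₂ tt) x = ⊥-elim (Z-notΣ {S = OnPlaneLine.ΦZ k t} (OnPlaneLine.ΦZ-InZ k t) x)
        distinct (inj₂ tt) (inj₁ (t , k)) x =
          ⊥-elim (Z-notΣ {S = OnPlaneLine.ΦZ k t} (OnPlaneLine.ΦZ-InZ k t) (≈-sym {X = Σs} {Y = OnPlaneLine.ΦZ k t} x))
        distinct (inj₂ tt) (inj₂ tt) x = refl
        complete : ∀ S → Member S → S ⊆ H → Σ (((C4 × SpreadIx q) × PlaneLine) ⊎ ⊤) λ t → S ≈ ΦH t
        complete S (inj₁ (k , S≈L)) sub = ⊥-elim (X-notH (A k) (⊆-trans {A = L (A k)} {B = S} {C = H} (proj₂ S≈L) sub))
        complete S (inj₂ (inj₂ e)) sub  = inj₂ tt , e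
        complete S (inj₂ (inj₁ z@(ℓ′ , j , isl′ , inSp , liS , S⊆′ , _))) sub = inj₁ (proj₁ r , k′) , proj₂ r
          where
            k′ = proj₁ (zLineInPlane S z sub)
            S⊆Γk : S ⊆ Γ (planeLine k′)
            S⊆Γk = ⊆-trans {A = S} {B = Γ ℓ′} {C = Γ (planeLine k′)} S⊆′
                     (Γ-mono ℓ′ (planeLine k′) (OnPlaneLine.hℓ k′) (proj₂ (zLineInPlane S z sub)))
            r = OnPlaneLine.classifyZ k′ S z S⊆Γk

open import Data.Nat using (_+_; _*_; _^_)

-- Proposition 5.4.  Λ = ⟨Σ, U₁, U₂⟩ works.
proposition5p4 : (q : ℕ) → IsPrimePower q → (F : Field) → HasOrder F q →
    let open Geometry F in
    (A : Fin (q ^ 12) → Mat) → IsMRD q A →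
    (P : Parallelism q 8) → IsParallelism q Σs P →
    (P′ : Parallelism q 8) → IsParallelism q Σ′ P′ →
    (μ : Permutation′ (suc (q * q + q))) →
    let open Family q A P P′ μ in
    Σ (Gens 6 8) λ Λ →
    LinIndep Λ
    × ContainsExactly (q ^ 4 * (q ^ 2 + 1) + 1) Λ
    × ((H : Gens 7 8) → LinIndep H → Λ ⊆ H →
    ContainsExactly (q ^ 4 * (q ^ 2 + 1) * (q ^ 2 + q + 1) + 1) H)
proposition5p4 q _ F iso A _ P parP P′ parP′ μ =
  Λ , Λ-li , ΛContains , AtHyperplane.HContains
  where open Proof F q iso A P parP P′ parP′ μ
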